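{- $n(3,6,2)=24$.
   Context: All graphs are finite, simple (no loops or parallel edges) and connected. For integers $v,k,g,\lambda$, an $egr(v,k,g,\lambda)$ graph (edge-girth-regular graph) is a $k$-regular graph of girth $g$ on $v$ vertices such that every edge is contained in exactly $\lambda$ cycles of length $g$. $n(k,g,\lambda)$ denotes the smallest integer $v$ such that an $egr(v,k,g,\lambda)$ graph exists, and $n(k,g,\lambda)=\infty$ if no such graph exists. -}

module Defs where

open import Data.Nat using (ℕ; zero; suc; _<_; _≤_; _≤ᵇ_)
open import Data.Bool using (Bool; true; false; _∧_; not; T; if_then_else_)
open import Data.Fin using (Fin; _≟_)
open import Data.List using (List; []; _∷_; length; map; concatMap; allFin)
open import Data.Bool.ListAction using (any)
open import Data.Product using (Σ; ∃; _×_)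
open import Relation.Nullary using (¬_)
open import Relation.Nullary.Decidable using (⌊_⌋)
open import Relation.Binary.PropositionalEquality using (_≡_)

record Graph (v : ℕ) : Set where
  field
    adj    : Fin v → Fin v → Bool
    sym    : ∀ i j → adj i j ≡ adj j i
    irrefl : ∀ i → adj i i ≡ false
open Graph public

countᵇ : {A : Set} → (A → Bool) → List A → ℕ
countᵇ p [] = 0
countᵇ p (x ∷ xs) = if p x then suc (countᵇ p xs) else countᵇ p xs

_==_ : {v : ℕ} → Fin v → Fin v → Bool
x == y = ⌊ x ≟ y ⌋

module _ {v : ℕ} (G : Graph v) where

  degree : Fin v → ℕ
  degree i = countᵇ (adj G i) (allFin v)

  Regular : ℕ → Set
  Regular k = ∀ i → degree i ≡ k

  data Walk : Fin v → Fin v → Set where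
    here : ∀ {i} → Walk i i
    step : ∀ {i j k} → T (adj G i j) → Walk j k → Walk i k

  Connected : Set
  Connected = ∀ i j → Walk i j

  allDistinct : List (Fin v) → Bool
  allDistinct [] = true
  allDistinct (x ∷ xs) = not (any (x ==_) xs) ∧ allDistinct xs

  adjChain : List (Fin v) → Bool
  adjChain [] = true
  adjChain (x ∷ []) = true
  adjChain (x ∷ y ∷ xs) = adj G x y ∧ adjChain (y ∷ xs)

  lastOf : Fin v → List (Fin v) → Fin v
  lastOf x [] = x
  lastOf x (y ∷ ys) = lastOf y ys

  closes : List (Fin v) → Bool
  closes [] = false
  closes (x ∷ xs) = adj G (lastOf x xs) x

  isCycle : List (Fin v) → Bool
  isCycle l = (3 ≤ᵇ length l) ∧ allDistinct l ∧ adjChain l ∧ closes l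

  HasCycle : ℕ → Set
  HasCycle n = Σ (List (Fin v)) λ l → length l ≡ n × T (isCycle l)

  Girth : ℕ → Set
  Girth g = HasCycle g × (∀ n → n < g → ¬ HasCycle n)

  allLists : ℕ → List (List (Fin v))
  allLists zero = [] ∷ []
  allLists (suc n) = concatMap (λ x → map (x ∷_) (allLists n)) (allFin v)

  startsWith : Fin v → Fin v → List (Fin v) → Bool
  startsWith u w (a ∷ b ∷ _) = (a == u) ∧ (b == w)
  startsWith u w _ = false

  -- number of cycles of length n containing the edge {u,w}.  Every such
  -- cycle has exactly one cyclic vertex sequence starting u, w, …
  -- (u first, then w, then around the cycle), so we count those sequences.
  cyclesThrough : ℕ → Fin v → Fin v → ℕ
  cyclesThrough n u w =
    countᵇ (λ l → isCycle l ∧ startsWith u w l) (allLists n)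

IsEGR : (v k g λ' : ℕ) → Graph v → Set
IsEGR v k g λ' G =
  Connected G × Regular G k × Girth G g ×
  (∀ u w → T (adj G u w) → cyclesThrough G g u w ≡ λ')

EGR : (v k g λ' : ℕ) → Set
EGR v k g λ' = Σ (Graph v) (IsEGR v k g λ')

NEquals : (k g λ' m : ℕ) → Set
NEquals k g λ' m = EGR m k g λ' × (∀ v → v < m → ¬ EGR v k g λ')

{-# OPTIONS --safe #-}
module Submission where

-- The Nauru graph GP(12,5) is a connected cubic graph of girth 6 in which every edge lies in
-- exactly two hexagons; all of this is checked by evaluation.
--
-- Conversely, let G be cubic with every edge in exactly two hexagons. If two hexagons passed
-- through a path x–u–y, they would be both hexagons of the edge uy and, reversed, both of ux,
-- leaving no way for a hexagon on the third edge at u to close up. And if no hexagon passed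
-- through x–u–y, both hexagons of uy would return to u through its third neighbour, so by the
-- above they would coincide. Hence every 2-path lies in exactly one hexagon. If moreover G has
-- girth 6 and fewer than 24 vertices, label a growing piece of G: repeatedly either identify the
-- missing neighbour of a vertex with fewer than three known neighbours, or walk around the hexagon
-- through a known 2-path, one vertex at a time, trying every labelled vertex and a fresh one.
-- Every branch of this search ends with a cycle shorter than 6, a second hexagon through some
-- 2-path, or 24 distinct vertices; the search tree is a certificate checked by evaluation.

open import Data.Bool using (Bool; true; false; T; _∧_; not; if_then_else_)
import Data.Bool as Bool
open import Data.Bool.ListAction using (all; any)
open import Data.Bool.Properties using (T-∧)
open import Data.Empty using (⊥; ⊥-elim)
open import Data.Fin as Fin using (Fin; toℕ; fromℕ<; zero; #_)
open import Data.Fin.Properties using (all?; any?; toℕ<n; toℕ-injective; toℕ-fromℕ<)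
import Data.Fin.Properties as Fin
open import Data.List
  using (List; []; _∷_; _++_; _∷ʳ_; length; map; concat; filterᵇ; allFin; upTo; take; drop; reverse)
open import Data.List.Properties
  using (length-++; length-map; map-++; map-∘; map-cong; ++-assoc; ++-identityʳ;
         ∷-injective; ∷-injectiveˡ; ∷-injectiveʳ; ≡-dec)
open import Data.List.Membership.Propositional using (_∈_; _∉_; find; lose)
open import Data.List.Membership.Propositional.Properties
  using (∈-∃++; ∈-++⁺ˡ; ∈-++⁺ʳ; ∈-++⁻; ∈-map⁺; ∈-map⁻; ∈-concatMap⁺; ∈-concatMap⁻;
         ∈-allFin; ∈-upTo⁺; ∈-filter⁺; ∈-filter⁻)
open import Data.List.Relation.Binary.Disjoint.Propositional using (Disjoint)
open import Data.List.Relation.Binary.Subset.Propositional using (_⊆_)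
open import Data.List.Relation.Unary.All as All using (All; []; _∷_)
open import Data.List.Relation.Unary.All.Properties using (all⁺; ++⁺; ++⁻ˡ; ¬Any⇒All¬; All¬⇒¬Any)
import Data.List.Relation.Unary.All.Properties as All
open import Data.List.Relation.Unary.Any as Any using (here; there)
open import Data.List.Relation.Unary.Any.Properties using (any⁺; any⁻)
open import Data.List.Relation.Unary.AllPairs as AllPairs using ([]; _∷_)
import Data.List.Relation.Unary.AllPairs.Properties as AllPairs
open import Data.List.Relation.Unary.Unique.Propositional using (Unique)
import Data.List.Relation.Unary.Unique.Propositional.Properties as Unique
open import Data.Maybe using (Maybe; just; nothing; maybe′)
open import Data.Nat using (ℕ; zero; suc; _+_; _∸_; _%_; _<_; _≤_; _<ᵇ_; _≤ᵇ_; _≡ᵇ_; z≤n; s≤s; _<?_; _≟_)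
open import Data.Nat.ListAction using (sum)
open import Data.Nat.Properties
  using (≡ᵇ⇒≡; ≡⇒≡ᵇ; <ᵇ⇒<; <⇒<ᵇ; ≤ᵇ⇒≤; ≮⇒≥; <⇒≱; <⇒≢; <-irrefl; ≤-refl; ≤-reflexive; ≤-trans; <-≤-trans;
         ≤-pred; ≤∧≢⇒<; m<n⇒m<1+n; n<1+n; m<1+n⇒m<n∨m≡n; suc-injective; +-suc; module ≤-Reasoning)
open import Data.List.Relation.Unary.Unique.DecPropositional _≟_ using (unique?)
open import Data.Product using (∃-syntax; _×_; _,_; proj₁; proj₂)
open import Data.Sum using (_⊎_; inj₁; inj₂)
open import Data.Unit using (tt)
open import Function using (_∘_; _⇔_; Equivalence; mk⇔)
open import Relation.Nullary using (¬_; yes; no; Dec)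
open import Relation.Nullary.Decidable
  using (⌊_⌋; toWitness; fromWitness; toWitnessFalse; decidable-stable; ¬?; T?; _×-dec_; _⊎-dec_; _→-dec_)
open import Relation.Binary.PropositionalEquality
  using (_≡_; _≢_; refl; sym; trans; cong; cong₂; subst; subst₂; setoid; ≢-sym; module ≡-Reasoning)

open import Defs renaming (sym to adj-sym)

-- Lists and counting

unique₃ : {A : Set} {x y z : A} → x ≢ y → x ≢ z → y ≢ z → Unique (x ∷ y ∷ z ∷ [])
unique₃ x≢y x≢z y≢z = (x≢y ∷ x≢z ∷ []) ∷ (y≢z ∷ []) ∷ [] ∷ []

T-∧⁻ : ∀ {a b} → T (a ∧ b) → T a × T b
T-∧⁻ = Equivalence.to T-∧

T-∧⁺ : ∀ {a b} → T a → T b → T (a ∧ b)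
T-∧⁺ p q = Equivalence.from T-∧ (p , q)

T-not⁻ : ∀ {b} → T (not b) → ¬ T b
T-not⁻ {false} _ ()

T-not⁺ : ∀ {b} → ¬ T b → T (not b)
T-not⁺ {true} ¬b = ¬b _
T-not⁺ {false} _ = _

module _ {A : Set} where

  countᵇ≡length∘filterᵇ : (p : A → Bool) (xs : List A) → countᵇ p xs ≡ length (filterᵇ p xs)
  countᵇ≡length∘filterᵇ p [] = refl
  countᵇ≡length∘filterᵇ p (x ∷ xs) with p x
  ... | true  = cong suc (countᵇ≡length∘filterᵇ p xs)
  ... | false = countᵇ≡length∘filterᵇ p xs

  unique⊆⇒length≤ : {xs ys : List A} → Unique xs → xs ⊆ ys → length xs ≤ length ys
  unique⊆⇒length≤ {[]} _ _ = z≤n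
  unique⊆⇒length≤ {x ∷ xs} (x∉xs ∷ !xs) xs⊆ys with ∈-∃++ (xs⊆ys (here refl))
  ... | ys₁ , ys₂ , refl = begin
    suc (length xs)                  ≤⟨ s≤s (unique⊆⇒length≤ !xs xs⊆ys₁++ys₂) ⟩
    suc (length (ys₁ ++ ys₂))        ≡⟨ cong suc (length-++ ys₁) ⟩
    suc (length ys₁ + length ys₂)    ≡⟨ +-suc _ _ ⟨
    length ys₁ + length (x ∷ ys₂)    ≡⟨ length-++ ys₁ ⟨
    length (ys₁ ++ x ∷ ys₂)          ∎
    where
    open ≤-Reasoning
    xs⊆ys₁++ys₂ : xs ⊆ ys₁ ++ ys₂
    xs⊆ys₁++ys₂ {z} z∈xs with ∈-++⁻ ys₁ (xs⊆ys (there z∈xs))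
    ... | inj₁ z∈ys₁ = ∈-++⁺ˡ z∈ys₁
    ... | inj₂ (here refl) = ⊥-elim (All.lookup x∉xs z∈xs refl)
    ... | inj₂ (there z∈ys₂) = ∈-++⁺ʳ ys₁ z∈ys₂

  countᵇ-++ : ∀ (p : A → Bool) xs ys → countᵇ p (xs ++ ys) ≡ countᵇ p xs + countᵇ p ys
  countᵇ-++ p [] ys = refl
  countᵇ-++ p (x ∷ xs) ys with p x
  ... | true  = cong suc (countᵇ-++ p xs ys)
  ... | false = countᵇ-++ p xs ys

  countᵇ-concat : ∀ (p : A → Bool) xss → countᵇ p (concat xss) ≡ sum (map (countᵇ p) xss)
  countᵇ-concat p [] = refl
  countᵇ-concat p (xs ∷ xss) =
    trans (countᵇ-++ p xs (concat xss)) (cong (countᵇ p xs +_) (countᵇ-concat p xss))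

  countᵇ-map : ∀ {B : Set} (p : B → Bool) (f : A → B) xs → countᵇ p (map f xs) ≡ countᵇ (p ∘ f) xs
  countᵇ-map p f [] = refl
  countᵇ-map p f (x ∷ xs) with p (f x)
  ... | true  = cong suc (countᵇ-map p f xs)
  ... | false = countᵇ-map p f xs

  countᵇ-cong : ∀ {p q : A → Bool} → (∀ x → p x ≡ q x) → ∀ xs → countᵇ p xs ≡ countᵇ q xs
  countᵇ-cong p≗q [] = refl
  countᵇ-cong {p} {q} p≗q (x ∷ xs) rewrite p≗q x with q x
  ... | true  = cong suc (countᵇ-cong p≗q xs)
  ... | false = countᵇ-cong p≗q xs

  countᵇ-none : ∀ {p : A → Bool} → (∀ x → ¬ T (p x)) → ∀ xs → countᵇ p xs ≡ 0
  countᵇ-none none [] = refl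
  countᵇ-none {p} none (x ∷ xs) with p x | none x
  ... | true  | ¬px = ⊥-elim (¬px _)
  ... | false | _   = countᵇ-none none xs

  countᵇ-∈ : ∀ {p : A → Bool} {x xs} → x ∈ xs → T (p x) → 0 < countᵇ p xs
  countᵇ-∈ {p} {xs = y ∷ ys} x∈ px with p y in py
  ... | true = s≤s z≤n
  countᵇ-∈ {p} (here refl) px | false = ⊥-elim (subst T py px)
  countᵇ-∈ {p} (there x∈) px | false = countᵇ-∈ x∈ px

unique-++⁻ˡ : ∀ {A : Set} {xs ys : List A} → Unique (xs ++ ys) → Unique xs
unique-++⁻ˡ {xs = []} _ = []
unique-++⁻ˡ {xs = x ∷ xs} (x∉ ∷ !xs) = ++⁻ˡ xs x∉ ∷ unique-++⁻ˡ !xs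

unique-++-∷⇒∉ : {A : Set} {xs ys : List A} {y : A} → Unique (xs ++ y ∷ ys) → y ∉ xs
unique-++-∷⇒∉ {xs = x ∷ xs} (x∉ ∷ _) (here refl) = All.lookup x∉ (∈-++⁺ʳ xs (here refl)) refl
unique-++-∷⇒∉ {xs = x ∷ xs} (_ ∷ !xs) (there y∈) = unique-++-∷⇒∉ !xs y∈

map-∷ʳ-++ : {A B : Set} (f : A → B) (xs : List A) (y : A) (ys : List B) →
            map f (xs ∷ʳ y) ++ ys ≡ map f xs ++ f y ∷ ys
map-∷ʳ-++ f xs y ys = trans (cong (_++ ys) (map-++ f xs (y ∷ []))) (++-assoc (map f xs) (f y ∷ []) ys)

module _ {v : ℕ} (G : Graph v) where

  ∈-allLists⁺ : ∀ n {l} → length l ≡ n → l ∈ allLists G n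
  ∈-allLists⁺ zero {[]} refl = here refl
  ∈-allLists⁺ (suc n) {x ∷ l} refl =
    ∈-concatMap⁺ (λ x → map (x ∷_) (allLists G n))
      (Any.map (λ { refl → ∈-map⁺ (x ∷_) (∈-allLists⁺ n refl) }) (∈-allFin x))

  ∈-allLists⁻ : ∀ n {l} → l ∈ allLists G n → length l ≡ n
  ∈-allLists⁻ zero (here refl) = refl
  ∈-allLists⁻ (suc n) l∈
    with Any.satisfied (∈-concatMap⁻ (λ x → map (x ∷_) (allLists G n)) {xs = allFin v} l∈)
  ... | x , l∈x∷ with ∈-map⁻ (x ∷_) l∈x∷
  ... | l′ , l′∈ , refl = cong suc (∈-allLists⁻ n l′∈)

  allLists-unique : ∀ n → Unique (allLists G n)
  allLists-unique zero = [] ∷ []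
  allLists-unique (suc n) =
    Unique.concat⁺ (All.map⁺ (All.tabulate λ _ → Unique.map⁺ ∷-injectiveʳ (allLists-unique n)))
                   (AllPairs.map⁺ (AllPairs.map disjoint (Unique.allFin⁺ v)))
    where
    disjoint : ∀ {x y} → x ≢ y → Disjoint (map (x ∷_) (allLists G n)) (map (y ∷_) (allLists G n))
    disjoint x≢y (l∈x∷ , l∈y∷) with ∈-map⁻ _ l∈x∷ | ∈-map⁻ _ l∈y∷
    ... | _ , _ , refl | _ , _ , eq = x≢y (proj₁ (∷-injective eq))

-- allLists G 6 is far too long to count over directly; pruned enumerates it depth first and
-- abandons a prefix as soon as no extension of it can satisfy P.
module PrunedCount {v : ℕ} (G : Graph v) (P viable : List (Fin v) → Bool)
                   (viable-prefix : ∀ pre l → T (P (pre ++ l)) → T (viable pre)) where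

  pruned : List (Fin v) → ℕ → ℕ
  pruned pre zero    = if viable pre then (if P pre then 1 else 0) else 0
  pruned pre (suc n) = if viable pre then sum (map (λ x → pruned (pre ∷ʳ x) n) (allFin v)) else 0

  countᵇ≡pruned : ∀ pre n → countᵇ (λ l → P (pre ++ l)) (allLists G n) ≡ pruned pre n
  countᵇ≡pruned pre zero with viable pre in eq
  ... | false = countᵇ-none (λ l h → subst T eq (viable-prefix pre l h)) (allLists G 0)
  ... | true  = cong (λ b → if b then 1 else 0) (cong P (++-identityʳ pre))
  countᵇ≡pruned pre (suc n) with viable pre in eq
  ... | false = countᵇ-none (λ l h → subst T eq (viable-prefix pre l h)) (allLists G (suc n))
  ... | true  = begin
    countᵇ (λ l → P (pre ++ l)) (concat (map (λ x → map (x ∷_) (allLists G n)) (allFin v)))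
      ≡⟨ countᵇ-concat _ (map (λ x → map (x ∷_) (allLists G n)) (allFin v)) ⟩
    sum (map (countᵇ (λ l → P (pre ++ l))) (map (λ x → map (x ∷_) (allLists G n)) (allFin v)))
      ≡⟨ cong sum (sym (map-∘ (allFin v))) ⟩
    sum (map (λ x → countᵇ (λ l → P (pre ++ l)) (map (x ∷_) (allLists G n))) (allFin v))
      ≡⟨ cong sum (map-cong prepend (allFin v)) ⟩
    sum (map (λ x → pruned (pre ∷ʳ x) n) (allFin v)) ∎
    where
    open ≡-Reasoning
    prepend : ∀ x → countᵇ (λ l → P (pre ++ l)) (map (x ∷_) (allLists G n)) ≡ pruned (pre ∷ʳ x) n
    prepend x = trans (countᵇ-map _ (x ∷_) (allLists G n))
                     (trans (countᵇ-cong (λ l → cong P (sym (++-assoc pre (x ∷ []) l))) (allLists G n))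
                            (countᵇ≡pruned (pre ∷ʳ x) n))

-- Cycles and hexagons

module Cycles {v : ℕ} (G : Graph v) where

  open import Data.List.Membership.DecPropositional (Fin._≟_ {v}) using (_∈?_)
  open import Data.List.Relation.Binary.Permutation.Setoid (setoid (Fin v)) using (↭-prep; ↭-sym)
  open import Data.List.Relation.Binary.Permutation.Setoid.Properties (setoid (Fin v))
    using (Unique-resp-↭; ↭-reverse; ∷↭∷ʳ)

  infix 4 _~_
  _~_ : Fin v → Fin v → Set
  u ~ w = T (adj G u w)

  ~-sym : ∀ {u w} → u ~ w → w ~ u
  ~-sym {u} {w} = subst T (adj-sym G u w)

  ~-irrefl : ∀ {u} → ¬ u ~ u
  ~-irrefl {u} = subst (¬_ ∘ T) (sym (irrefl G u)) λ ()

  allDistinct⇔Unique : ∀ l → T (allDistinct G l) ⇔ Unique l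
  allDistinct⇔Unique l = mk⇔ (to l) (from l)
    where
    fresh⁻ : ∀ {x} xs → T (not (any (x ==_) xs)) → All (x ≢_) xs
    fresh⁻ xs h = ¬Any⇒All¬ xs λ x∈ → T-not⁻ h (any⁺ _ (Any.map (λ { refl → fromWitness refl }) x∈))
    fresh⁺ : ∀ {x} xs → All (x ≢_) xs → T (not (any (x ==_) xs))
    fresh⁺ xs x∉ = T-not⁺ λ h → All¬⇒¬Any x∉ (Any.map toWitness (any⁻ _ xs h))
    to : ∀ l → T (allDistinct G l) → Unique l
    to [] _ = []
    to (x ∷ xs) h = let (x∉ , d) = T-∧⁻ h in fresh⁻ xs x∉ ∷ to xs d
    from : ∀ l → Unique l → T (allDistinct G l)
    from [] _ = _
    from (x ∷ xs) (x∉ ∷ d) = T-∧⁺ (fresh⁺ xs x∉) (from xs d)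

  record Hexagon (u y a b c x : Fin v) : Set where
    field
      distinct : Unique (u ∷ y ∷ a ∷ b ∷ c ∷ x ∷ [])
      u~y : u ~ y
      y~a : y ~ a
      a~b : a ~ b
      b~c : b ~ c
      c~x : c ~ x
      x~u : x ~ u

  isCycle⇒Hexagon : ∀ {u y a b c x} → T (isCycle G (u ∷ y ∷ a ∷ b ∷ c ∷ x ∷ [])) → Hexagon u y a b c x
  isCycle⇒Hexagon h =
    let (d , h₁) = T-∧⁻ h ; (chain , x~u) = T-∧⁻ h₁
        (u~y , c₁) = T-∧⁻ chain ; (y~a , c₂) = T-∧⁻ c₁ ; (a~b , c₃) = T-∧⁻ c₂
        (b~c , c₄) = T-∧⁻ c₃ ; (c~x , _) = T-∧⁻ c₄
    in record { distinct = Equivalence.to (allDistinct⇔Unique _) d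
              ; u~y = u~y ; y~a = y~a ; a~b = a~b ; b~c = b~c ; c~x = c~x ; x~u = x~u }

  Hexagon⇒isCycle : ∀ {u y a b c x} → Hexagon u y a b c x → T (isCycle G (u ∷ y ∷ a ∷ b ∷ c ∷ x ∷ []))
  Hexagon⇒isCycle H = T-∧⁺ (Equivalence.from (allDistinct⇔Unique _) distinct)
    (T-∧⁺ (T-∧⁺ u~y (T-∧⁺ y~a (T-∧⁺ a~b (T-∧⁺ b~c (T-∧⁺ c~x _))))) x~u)
    where open Hexagon H

  Hexagon-reverse : ∀ {u y a b c x} → Hexagon u y a b c x → Hexagon u x c b a y
  Hexagon-reverse {u} {y} {a} {b} {c} {x} H = record
    { distinct = Unique-resp-↭ (↭-prep u (↭-sym (↭-reverse (y ∷ a ∷ b ∷ c ∷ x ∷ [])))) distinct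
    ; u~y = ~-sym x~u ; y~a = ~-sym c~x ; a~b = ~-sym b~c
    ; b~c = ~-sym a~b ; c~x = ~-sym y~a ; x~u = ~-sym u~y
    }
    where open Hexagon H

  Hexagon-rotate : ∀ {u y a b c x} → Hexagon u y a b c x → Unique (x ∷ u ∷ y ∷ a ∷ b ∷ c ∷ [])
  Hexagon-rotate {u} {y} {a} {b} {c} {x} H =
    Unique-resp-↭ (↭-sym (∷↭∷ʳ x (u ∷ y ∷ a ∷ b ∷ c ∷ []))) (Hexagon.distinct H)

  second≢last : ∀ {u y a b c x} → Hexagon u y a b c x → y ≢ x
  second≢last record { distinct = _ ∷ (_ ∷ _ ∷ _ ∷ y≢x ∷ []) ∷ _ } = y≢x

  cycleFromᵇ : Fin v → Fin v → List (Fin v) → Bool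
  cycleFromᵇ u y l = isCycle G l ∧ startsWith G u y l

  hexagonsFrom : Fin v → Fin v → List (List (Fin v))
  hexagonsFrom u y = filterᵇ (cycleFromᵇ u y) (allLists G 6)

  data HexagonFrom (u y : Fin v) : List (Fin v) → Set where
    hexagon : ∀ {a b c x} → Hexagon u y a b c x → HexagonFrom u y (u ∷ y ∷ a ∷ b ∷ c ∷ x ∷ [])

  ∈-hexagonsFrom⁺ : ∀ {u y l} → HexagonFrom u y l → l ∈ hexagonsFrom u y
  ∈-hexagonsFrom⁺ {u} {y} (hexagon H) =
    ∈-filter⁺ (T? ∘ cycleFromᵇ u y) (∈-allLists⁺ G 6 refl)
      (T-∧⁺ (Hexagon⇒isCycle H)
            (T-∧⁺ (fromWitness {a? = u Fin.≟ u} refl) (fromWitness {a? = y Fin.≟ y} refl)))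

  ∈-hexagonsFrom⁻ : ∀ {u y l} → l ∈ hexagonsFrom u y → HexagonFrom u y l
  ∈-hexagonsFrom⁻ {u} {y} {l} l∈ =
    let (l∈all , h) = ∈-filter⁻ (T? ∘ cycleFromᵇ u y) l∈ in decode l (∈-allLists⁻ G 6 l∈all) h
    where
    decode : ∀ l → length l ≡ 6 → T (cycleFromᵇ u y l) → HexagonFrom u y l
    decode l@(u′ ∷ y′ ∷ _ ∷ _ ∷ _ ∷ _ ∷ []) refl h with T-∧⁻ {isCycle G l} h
    ... | cycle , start with T-∧⁻ {u′ == u} start
    ... | first , second with toWitness {a? = u′ Fin.≟ u} first | toWitness {a? = y′ Fin.≟ y} second
    ... | refl | refl = hexagon (isCycle⇒Hexagon cycle)

  hexagonsFrom-unique : ∀ u y → Unique (hexagonsFrom u y)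
  hexagonsFrom-unique u y = Unique.filter⁺ (T? ∘ cycleFromᵇ u y) (allLists-unique G 6)

  adjChain-prefix : ∀ pre l → T (adjChain G (pre ++ l)) → T (adjChain G pre)
  adjChain-prefix [] l _ = _
  adjChain-prefix (x ∷ []) l _ = _
  adjChain-prefix (x ∷ y ∷ pre) l h =
    let (x~y , h′) = T-∧⁻ {adj G x y} h in T-∧⁺ x~y (adjChain-prefix (y ∷ pre) l h′)

  pathᵇ : List (Fin v) → Bool
  pathᵇ l = allDistinct G l ∧ adjChain G l

  cycle-prefix : ∀ pre l → T (isCycle G (pre ++ l)) → T (pathᵇ pre)
  cycle-prefix pre l h =
    let (_ , h₁) = T-∧⁻ {3 ≤ᵇ length (pre ++ l)} h
        (distinct , h₂) = T-∧⁻ {allDistinct G (pre ++ l)} h₁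
    in T-∧⁺ (Equivalence.from (allDistinct⇔Unique pre)
               (unique-++⁻ˡ (Equivalence.to (allDistinct⇔Unique (pre ++ l)) distinct)))
            (adjChain-prefix pre l (proj₁ (T-∧⁻ h₂)))

  module AllCycles = PrunedCount G (isCycle G) pathᵇ cycle-prefix

  no-cycles : ∀ n → AllCycles.pruned [] n ≡ 0 → ¬ HasCycle G n
  no-cycles n none (l , refl , cycle) with
    subst (0 <_) (trans (AllCycles.countᵇ≡pruned [] (length l)) none)
          (countᵇ-∈ {p = isCycle G} {l} (∈-allLists⁺ G (length l) refl) cycle)
  ... | ()

  startsLike : Fin v → Fin v → List (Fin v) → Bool
  startsLike u w []          = true
  startsLike u w (a ∷ [])    = a == u
  startsLike u w (a ∷ b ∷ _) = (a == u) ∧ (b == w)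

  startsWith-prefix : ∀ u w pre l → T (startsWith G u w (pre ++ l)) → T (startsLike u w pre)
  startsWith-prefix u w [] l _ = _
  startsWith-prefix u w (a ∷ []) (b ∷ l) h = proj₁ (T-∧⁻ {a == u} h)
  startsWith-prefix u w (a ∷ b ∷ pre) l h = h

  cycleFrom-prefix : ∀ u w pre l → T (cycleFromᵇ u w (pre ++ l)) → T (pathᵇ pre ∧ startsLike u w pre)
  cycleFrom-prefix u w pre l h =
    let (cycle , start) = T-∧⁻ {isCycle G (pre ++ l)} h
    in T-∧⁺ (cycle-prefix pre l cycle) (startsWith-prefix u w pre l start)

  module CyclesFrom (u w : Fin v) =
    PrunedCount G (cycleFromᵇ u w) (λ pre → pathᵇ pre ∧ startsLike u w pre) (cycleFrom-prefix u w)

  cyclesThrough≡pruned : ∀ n u w → cyclesThrough G n u w ≡ CyclesFrom.pruned u w [] n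
  cyclesThrough≡pruned n u w = CyclesFrom.countᵇ≡pruned u w [] n

  module Cubic (cubic : Regular G 3) where

    neighbourList : Fin v → List (Fin v)
    neighbourList u = filterᵇ (adj G u) (allFin v)

    ∈-neighbourList⁺ : ∀ {u t} → u ~ t → t ∈ neighbourList u
    ∈-neighbourList⁺ {u} u~t = ∈-filter⁺ (T? ∘ adj G u) (∈-allFin _) u~t

    neighbourList-length : ∀ u → length (neighbourList u) ≡ 3
    neighbourList-length u = trans (sym (countᵇ≡length∘filterᵇ (adj G u) (allFin v))) (cubic u)

    neighbour-in : ∀ {u t L} → Unique L → All (u ~_) L → 3 ≤ length L → u ~ t → t ∈ L
    neighbour-in {u} {t} {L} !L L~ 3≤|L| u~t = decidable-stable (t ∈? L) λ t∉L →
      <-irrefl refl (≤-trans (s≤s 3≤|L|) (≤-trans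
        (unique⊆⇒length≤ (¬Any⇒All¬ L t∉L ∷ !L) λ z∈ → ∈-neighbourList⁺ (All.lookup (u~t ∷ L~) z∈))
        (≤-reflexive (neighbourList-length u))))

    neighbour-outside : ∀ {u L} → length L < 3 → ∃[ t ] u ~ t × t ∉ L
    neighbour-outside {u} {L} |L|<3 with Any.any? (λ t → ¬? (t ∈? L)) (neighbourList u)
    ... | yes outside =
      let (t , t∈ , t∉L) = find outside in t , proj₂ (∈-filter⁻ (T? ∘ adj G u) {xs = allFin v} t∈) , t∉L
    ... | no none = ⊥-elim (<-irrefl refl (≤-trans |L|<3 (≤-trans (≤-reflexive (sym (neighbourList-length u)))
        (unique⊆⇒length≤ (Unique.filter⁺ (T? ∘ adj G u) {allFin v} (Unique.allFin⁺ v))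
          λ z∈ → decidable-stable (_ ∈? L) λ z∉L → none (lose {P = λ t → t ∉ L} z∈ z∉L)))))

  module HexagonStructure (cubic : Regular G 3)
                          (hexagonsPerEdge : ∀ u w → u ~ w → cyclesThrough G 6 u w ≡ 2) where

    open Cubic cubic

    hexagonsFrom-length : ∀ {u y} → u ~ y → length (hexagonsFrom u y) ≡ 2
    hexagonsFrom-length {u} {y} u~y =
      trans (sym (countᵇ≡length∘filterᵇ (cycleFromᵇ u y) (allLists G 6))) (hexagonsPerEdge u y u~y)

    no-third-hexagon : ∀ {u y l₁ l₂ l₃} → HexagonFrom u y l₁ → HexagonFrom u y l₂ → HexagonFrom u y l₃ →
                       Unique (l₁ ∷ l₂ ∷ l₃ ∷ []) → ⊥
    no-third-hexagon h₁@(hexagon H) h₂ h₃ !ls = <-irrefl refl (≤-trans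
      (unique⊆⇒length≤ !ls λ { (here refl) → ∈-hexagonsFrom⁺ h₁ ; (there (here refl)) → ∈-hexagonsFrom⁺ h₂
                             ; (there (there (here refl))) → ∈-hexagonsFrom⁺ h₃ })
      (≤-reflexive (hexagonsFrom-length (Hexagon.u~y H))))

    two-hexagons : ∀ {u y} → u ~ y → ∃[ l₁ ] ∃[ l₂ ] HexagonFrom u y l₁ × HexagonFrom u y l₂ × l₁ ≢ l₂
    two-hexagons {u} {y} u~y =
      pair (hexagonsFrom u y) (hexagonsFrom-length u~y) (hexagonsFrom-unique u y) ∈-hexagonsFrom⁻
      where
      pair : ∀ hs → length hs ≡ 2 → Unique hs → (∀ {l} → l ∈ hs → HexagonFrom u y l) →
             ∃[ l₁ ] ∃[ l₂ ] HexagonFrom u y l₁ × HexagonFrom u y l₂ × l₁ ≢ l₂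
      pair (l₁ ∷ l₂ ∷ []) refl ((l₁≢l₂ ∷ []) ∷ _) from =
        l₁ , l₂ , from (here refl) , from (there (here refl)) , l₁≢l₂

    hexagon-end : ∀ {u y a b c x a′ b′ c′ a″ b″ c″ r} → Hexagon u y a b c x → Hexagon u y a′ b′ c′ x →
                  (a ∷ b ∷ c ∷ []) ≢ (a′ ∷ b′ ∷ c′ ∷ []) → Hexagon u y a″ b″ c″ r → r ≡ x
    hexagon-end {u} {y} {x = x} {r = r} H₁ H₂ abc≢ H₃ = decidable-stable (r Fin.≟ x) λ r≢x →
      let ends-differ : ∀ {a b c a″ b″ c″} → (u ∷ y ∷ a ∷ b ∷ c ∷ x ∷ []) ≢ (u ∷ y ∷ a″ ∷ b″ ∷ c″ ∷ r ∷ [])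
          ends-differ eq = r≢x (sym (∷-injectiveˡ (cong (drop 5) eq)))
      in no-third-hexagon (hexagon H₁) (hexagon H₂) (hexagon H₃)
           ((abc≢ ∘ cong (take 3 ∘ drop 2) ∷ ends-differ ∷ []) ∷ (ends-differ ∷ []) ∷ [] ∷ [])

    hexagon-unique : ∀ {u y a b c x a′ b′ c′} → Hexagon u y a b c x → Hexagon u y a′ b′ c′ x →
                     (a ∷ b ∷ c ∷ []) ≡ (a′ ∷ b′ ∷ c′ ∷ [])
    hexagon-unique {u} {y} {a} {b} {c} {x} {a′} {b′} {c′} H₁ H₂
      with ≡-dec Fin._≟_ (a ∷ b ∷ c ∷ []) (a′ ∷ b′ ∷ c′ ∷ [])
    ... | yes abc≡ = abc≡
    ... | no abc≢ with neighbour-outside {u} {x ∷ y ∷ []} (s≤s (s≤s (s≤s z≤n)))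
    ... | z , u~z , z∉xy with two-hexagons u~z
    ... | _ , _ , hexagon H₃ , _ with neighbour-in
          (unique₃ (≢-sym (second≢last H₁)) (z∉xy ∘ here ∘ sym) (z∉xy ∘ there ∘ here ∘ sym))
          (~-sym (Hexagon.x~u H₁) ∷ Hexagon.u~y H₁ ∷ u~z ∷ []) ≤-refl (~-sym (Hexagon.x~u H₃))
    ... | here refl = ⊥-elim (z∉xy (there (here
            (hexagon-end (Hexagon-reverse H₁) (Hexagon-reverse H₂) (abc≢ ∘ cong reverse) (Hexagon-reverse H₃)))))
    ... | there (here refl) = ⊥-elim (z∉xy (here (hexagon-end H₁ H₂ abc≢ (Hexagon-reverse H₃))))
    ... | there (there (here refl)) = ⊥-elim (second≢last H₃ refl)

    hexagon-exists : ∀ {u x y} → u ~ x → u ~ y → x ≢ y → ∃[ a ] ∃[ b ] ∃[ c ] Hexagon u y a b c x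
    hexagon-exists {u} {x} {y} u~x u~y x≢y with two-hexagons u~y
    ... | _ , _ , hexagon {a} {b} {c} {r} H₁ , hexagon {a′} {b′} {c′} {r′} H₂ , l₁≢l₂
      with r Fin.≟ x | r′ Fin.≟ x
    ... | yes refl | _ = a , b , c , H₁
    ... | no _ | yes refl = a′ , b′ , c′ , H₂
    ... | no r≢x | no r′≢x with neighbour-in (unique₃ x≢y (r≢x ∘ sym) (second≢last H₁))
                                (u~x ∷ u~y ∷ ~-sym (Hexagon.x~u H₁) ∷ []) ≤-refl (~-sym (Hexagon.x~u H₂))
    ...   | here r′≡x = ⊥-elim (r′≢x r′≡x)
    ...   | there (here r′≡y) = ⊥-elim (second≢last H₂ (sym r′≡y))
    ...   | there (there (here refl)) =
      ⊥-elim (l₁≢l₂ (cong (λ abc → u ∷ y ∷ abc ++ r ∷ []) (hexagon-unique H₁ H₂)))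

module Walks {v : ℕ} (G : Graph v) where

  _++ʷ_ : ∀ {i j k} → Walk G i j → Walk G j k → Walk G i k
  here ++ʷ w′ = w′
  step i~j w ++ʷ w′ = step i~j (w ++ʷ w′)

  reverseʷ : ∀ {i j} → Walk G i j → Walk G j i
  reverseʷ here = here
  reverseʷ (step {i} {j} i~j w) = reverseʷ w ++ʷ step (subst T (adj-sym G i j) i~j) here

descending⇒connected : ∀ {n} (G : Graph (suc n)) →
                       (∀ i → toℕ i ≡ 0 ⊎ ∃[ j ] T (adj G i j) × toℕ j < toℕ i) → Connected G
descending⇒connected {n} G descend i j =
  toZero (suc (toℕ i)) i ≤-refl ++ʷ reverseʷ (toZero (suc (toℕ j)) j ≤-refl)
  where
  open Walks G
  toZero : ∀ m i → toℕ i < m → Walk G i zero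
  toZero (suc m) i i<m with descend i
  ... | inj₁ i≡0 = subst (λ k → Walk G k zero) (sym (toℕ-injective {i = i} {j = zero} i≡0)) here
  ... | inj₂ (j , i~j , j<i) = step i~j (toZero m j (<-≤-trans j<i (≤-pred i<m)))

no-tiny-cycles : ∀ {v} (G : Graph v) n → n < 3 → ¬ HasCycle G n
no-tiny-cycles G n n<3 (l , refl , cycle) = <⇒≱ n<3 (≤ᵇ⇒≤ 3 (length l) (proj₁ (T-∧⁻ {3 ≤ᵇ length l} cycle)))

-- Partial graphs and search certificates

infixr 5 _⇒ᵇ_
_⇒ᵇ_ : Bool → Bool → Bool
true  ⇒ᵇ b = b
false ⇒ᵇ _ = true

⇒ᵇ-elim : ∀ {a b} → T (a ⇒ᵇ b) → T a → T b
⇒ᵇ-elim {true} h _ = h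

infix 4 _∈ᵇ_
_∈ᵇ_ : ℕ → List ℕ → Bool
i ∈ᵇ l = any (i ≡ᵇ_) l

∈ᵇ⇒∈ : ∀ {i l} → T (i ∈ᵇ l) → i ∈ l
∈ᵇ⇒∈ {i} {l} h = Any.map (≡ᵇ⇒≡ i _) (any⁻ (i ≡ᵇ_) l h)

∈⇒∈ᵇ : ∀ {i l} → i ∈ l → T (i ∈ᵇ l)
∈⇒∈ᵇ {i} i∈ = any⁺ (i ≡ᵇ_) (Any.map (λ { refl → ≡⇒≡ᵇ i i refl }) i∈)

∉⇒¬∈ᵇ : ∀ {i l} → i ∉ l → T (not (i ∈ᵇ l))
∉⇒¬∈ᵇ i∉ = T-not⁺ (i∉ ∘ ∈ᵇ⇒∈)

record PartialGraph : Set where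
  field
    order      : ℕ
    neighbours : ℕ → List ℕ
open PartialGraph

free : PartialGraph → ℕ → Bool
free S i = length (neighbours S i) <ᵇ 3

addEdge : PartialGraph → ℕ → ℕ → PartialGraph
addEdge S p i = record S
  { neighbours = λ j → if ⌊ j ≟ p ⌋ then i ∷ neighbours S p
                       else if ⌊ j ≟ i ⌋ then p ∷ neighbours S i
                       else neighbours S j }

addVertex : PartialGraph → ℕ → PartialGraph
addVertex S p = record
  { order      = suc (order S)
  ; neighbours = λ j → if ⌊ j ≟ order S ⌋ then p ∷ []
                       else if ⌊ j ≟ p ⌋ then order S ∷ neighbours S p
                       else neighbours S j }

viaEdge : PartialGraph → ℕ → ℕ → (PartialGraph → Bool) → Bool
viaEdge S p i k = if i ∈ᵇ neighbours S p then k S else ((free S p ∧ free S i) ⇒ᵇ k (addEdge S p i))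

knownPath : PartialGraph → List ℕ → Bool
knownPath S (i ∷ j ∷ l) = (j ∈ᵇ neighbours S i) ∧ knownPath S (j ∷ l)
knownPath S _           = true

lastLabel : ℕ → List ℕ → ℕ
lastLabel i []      = i
lastLabel i (j ∷ l) = lastLabel j l

knownCycle : PartialGraph → List ℕ → Bool
knownCycle S []      = false
knownCycle S (i ∷ l) = (3 ≤ᵇ length (i ∷ l)) ∧ all (_<ᵇ order S) (i ∷ l) ∧ ⌊ unique? (i ∷ l) ⌋ ∧
                       knownPath S (i ∷ l) ∧ (i ∈ᵇ neighbours S (lastLabel i l))

branch : {A : Set} → List (ℕ × A) → ℕ → (A → Bool) → Bool
branch bs i f = any (λ { (j , a) → (j ≡ᵇ i) ∧ f a }) bs

-- Labels 0, 1, … of a partial graph name distinct vertices of G. A Route r walks around the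
-- hexagon through a known 2-path x–u–y, with r vertices left before it closes up at x; each step
-- has a branch for every label the next vertex might carry, and one for a fresh vertex; nothing
-- marks a step that cannot occur because a vertex is already saturated.
mutual
  data Certificate : Set where
    pigeonhole  : Certificate
    shortCycle  : List ℕ → Certificate
    twoHexagons : (x u y a b c a′ b′ c′ : ℕ) → Certificate
    newNeighbour : (u : ℕ) → List (ℕ × Certificate) → Certificate → Certificate
    hexagonAt   : (x u y : ℕ) → Route 3 → Certificate

  data Route : ℕ → Set where
    close    : Maybe Certificate → Route zero
    advance  : ∀ {r} → List (ℕ × Route r) → Maybe (Route r) → Route (suc r)
    conclude : ∀ {r} → Certificate → Route (suc r)

-- The first argument is fuel bounding the depth of the certificate.
mutual
  check : ℕ → PartialGraph → Certificate → Bool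
  check zero    S _ = false
  check (suc n) S pigeonhole = 24 ≤ᵇ order S
  check (suc n) S (shortCycle l) = knownCycle S l ∧ (length l <ᵇ 6)
  check (suc n) S (twoHexagons x u y a b c a′ b′ c′) =
    knownCycle S (u ∷ y ∷ a ∷ b ∷ c ∷ x ∷ []) ∧ knownCycle S (u ∷ y ∷ a′ ∷ b′ ∷ c′ ∷ x ∷ []) ∧
    not ⌊ ≡-dec _≟_ (a ∷ b ∷ c ∷ []) (a′ ∷ b′ ∷ c′ ∷ []) ⌋
  check (suc n) S (newNeighbour u cs c) =
    (u <ᵇ order S) ∧ free S u ∧ all (newNeighbourIs n S u cs) (upTo (order S)) ∧
    check n (addVertex S u) c
  check (suc n) S (hexagonAt x u y route) =
    (u <ᵇ order S) ∧ (x ∈ᵇ neighbours S u) ∧ (y ∈ᵇ neighbours S u) ∧ not (x ≡ᵇ y) ∧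
    follow n S x y (x ∷ u ∷ y ∷ []) route

  follow : ∀ {r} → ℕ → PartialGraph → (x p : ℕ) → List ℕ → Route r → Bool
  follow zero    S x p trail _ = false
  follow (suc n) S x p trail (close c) = viaEdge S p x λ S′ → maybe′ (check n S′) false c
  follow (suc n) S x p trail (advance rs next) =
    all (nextVertexIs n S x p trail rs) (upTo (order S)) ∧
    (free S p ⇒ᵇ maybe′ (follow n (addVertex S p) x (order S) (trail ∷ʳ order S)) false next)
  follow (suc n) S x p trail (conclude c) = check n S c

  newNeighbourIs : ℕ → PartialGraph → ℕ → List (ℕ × Certificate) → ℕ → Bool
  newNeighbourIs n S u cs i =
    not (i ∈ᵇ u ∷ neighbours S u) ⇒ᵇ viaEdge S u i λ S′ → branch cs i (check n S′)

  nextVertexIs : ∀ {r} → ℕ → PartialGraph → (x p : ℕ) → List ℕ → List (ℕ × Route r) → ℕ → Bool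
  nextVertexIs n S x p trail rs i =
    not (i ∈ᵇ trail) ⇒ᵇ viaEdge S p i λ S′ → branch rs i (follow n S′ x i (trail ∷ʳ i))

-- Soundness of the certificate check

all-upTo⁻ : ∀ {f : ℕ → Bool} {n i} → T (all f (upTo n)) → i < n → T (f i)
all-upTo⁻ {f} {n} h i<n = All.lookup (all⁺ f (upTo n) h) (∈-upTo⁺ i<n)

branch⁻ : ∀ {A : Set} {bs : List (ℕ × A)} {i f} → T (branch bs i f) → ∃[ a ] T (f a)
branch⁻ {bs = bs} {i} h with Any.satisfied (any⁻ _ bs h)
... | (j , a) , h′ = a , proj₂ (T-∧⁻ {j ≡ᵇ i} h′)

newNeighbourIs⁻ : ∀ {n S u cs i} → T (all (newNeighbourIs n S u cs) (upTo (order S))) → i < order S →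
                  i ∉ u ∷ neighbours S u → T (viaEdge S u i λ S′ → branch cs i (check n S′))
newNeighbourIs⁻ {n} {S} {u} {cs} {i} h i< i∉ =
  ⇒ᵇ-elim {not (i ∈ᵇ u ∷ neighbours S u)} (all-upTo⁻ {newNeighbourIs n S u cs} h i<) (∉⇒¬∈ᵇ i∉)

nextVertexIs⁻ : ∀ {n S x p trail r} {rs : List (ℕ × Route r)} {i} →
                T (all (nextVertexIs n S x p trail rs) (upTo (order S))) → i < order S → i ∉ trail →
                T (viaEdge S p i λ S′ → branch rs i (follow n S′ x i (trail ∷ʳ i)))
nextVertexIs⁻ {n} {S} {x} {p} {trail} {rs = rs} {i} h i< i∉ =
  ⇒ᵇ-elim {not (i ∈ᵇ trail)} (all-upTo⁻ {nextVertexIs n S x p trail rs} h i<) (∉⇒¬∈ᵇ i∉)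

record WellFormed (S : PartialGraph) : Set where
  field
    unique    : ∀ {i} → i < order S → Unique (neighbours S i)
    bounded   : ∀ {i j} → i < order S → j ∈ neighbours S i → j < order S
    symmetric : ∀ {i j} → i < order S → j ∈ neighbours S i → i ∈ neighbours S j
open WellFormed

module _ {S : PartialGraph} {p i : ℕ} where

  ∈-addEdge⁻ : ∀ {m j} → j ∈ neighbours (addEdge S p i) m →
               (m ≡ p × j ≡ i) ⊎ (m ≡ i × j ≡ p) ⊎ j ∈ neighbours S m
  ∈-addEdge⁻ {m} j∈ with m ≟ p
  ∈-addEdge⁻ (here refl) | yes refl = inj₁ (refl , refl)
  ∈-addEdge⁻ (there j∈)  | yes refl = inj₂ (inj₂ j∈)
  ... | no _ with m ≟ i
  ∈-addEdge⁻ (here refl) | no _ | yes refl = inj₂ (inj₁ (refl , refl))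
  ∈-addEdge⁻ (there j∈)  | no _ | yes refl = inj₂ (inj₂ j∈)
  ∈-addEdge⁻ j∈          | no _ | no _ = inj₂ (inj₂ j∈)

  ∈-addEdge⁺ : ∀ {m j} → j ∈ neighbours S m → j ∈ neighbours (addEdge S p i) m
  ∈-addEdge⁺ {m} j∈ with m ≟ p
  ... | yes refl = there j∈
  ... | no _ with m ≟ i
  ...   | yes refl = there j∈
  ...   | no _ = j∈

  addEdge-end : i ∈ neighbours (addEdge S p i) p
  addEdge-end with p ≟ p
  ... | yes _ = here refl
  ... | no p≢p = ⊥-elim (p≢p refl)

  addEdge-start : p ≢ i → p ∈ neighbours (addEdge S p i) i
  addEdge-start p≢i with i ≟ p
  ... | yes refl = ⊥-elim (p≢i refl)
  ... | no _ with i ≟ i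
  ...   | yes _ = here refl
  ...   | no i≢i = ⊥-elim (i≢i refl)

  addEdge-wellFormed : WellFormed S → p < order S → i < order S → p ≢ i → i ∉ neighbours S p →
                       WellFormed (addEdge S p i)
  addEdge-wellFormed W p< i< p≢i i∉ = record { unique = unique′ ; bounded = bounded′ ; symmetric = symmetric′ }
    where
    unique′ : ∀ {m} → m < order S → Unique (neighbours (addEdge S p i) m)
    unique′ {m} m< with m ≟ p
    ... | yes refl = ¬Any⇒All¬ _ i∉ ∷ unique W p<
    ... | no _ with m ≟ i
    ...   | yes refl = ¬Any⇒All¬ _ (i∉ ∘ symmetric W i<) ∷ unique W i<
    ...   | no _ = unique W m<
    bounded′ : ∀ {m j} → m < order S → j ∈ neighbours (addEdge S p i) m → j < order S
    bounded′ {m} m< j∈ with ∈-addEdge⁻ {m} j∈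
    ... | inj₁ (_ , refl) = i<
    ... | inj₂ (inj₁ (_ , refl)) = p<
    ... | inj₂ (inj₂ j∈′) = bounded W m< j∈′
    symmetric′ : ∀ {m j} → m < order S → j ∈ neighbours (addEdge S p i) m → m ∈ neighbours (addEdge S p i) j
    symmetric′ {m} m< j∈ with ∈-addEdge⁻ {m} j∈
    ... | inj₁ (refl , refl) = addEdge-start p≢i
    ... | inj₂ (inj₁ (refl , refl)) = addEdge-end
    ... | inj₂ (inj₂ j∈′) = ∈-addEdge⁺ (symmetric W m< j∈′)

module _ {S : PartialGraph} {p : ℕ} where

  ∈-addVertex⁻ : ∀ {m j} → j ∈ neighbours (addVertex S p) m →
                 (m ≡ order S × j ≡ p) ⊎ (m ≡ p × j ≡ order S) ⊎ (m ≢ order S × j ∈ neighbours S m)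
  ∈-addVertex⁻ {m} j∈ with m ≟ order S
  ∈-addVertex⁻ (here refl) | yes refl = inj₁ (refl , refl)
  ... | no m≢ with m ≟ p
  ∈-addVertex⁻ (here refl) | no _ | yes refl = inj₂ (inj₁ (refl , refl))
  ∈-addVertex⁻ (there j∈)  | no m≢ | yes refl = inj₂ (inj₂ (m≢ , j∈))
  ∈-addVertex⁻ j∈          | no m≢ | no _ = inj₂ (inj₂ (m≢ , j∈))

  ∈-addVertex⁺ : ∀ {m j} → m ≢ order S → j ∈ neighbours S m → j ∈ neighbours (addVertex S p) m
  ∈-addVertex⁺ {m} m≢ j∈ with m ≟ order S
  ... | yes m≡ = ⊥-elim (m≢ m≡)
  ... | no _ with m ≟ p
  ...   | yes refl = there j∈
  ...   | no _ = j∈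

  addVertex-new : neighbours (addVertex S p) (order S) ≡ p ∷ []
  addVertex-new with order S ≟ order S
  ... | yes _ = refl
  ... | no n≢n = ⊥-elim (n≢n refl)

  addVertex-old : p < order S → neighbours (addVertex S p) p ≡ order S ∷ neighbours S p
  addVertex-old p< with p ≟ order S
  ... | yes refl = ⊥-elim (<-irrefl refl p<)
  ... | no _ with p ≟ p
  ...   | yes _ = refl
  ...   | no p≢p = ⊥-elim (p≢p refl)

  addVertex-wellFormed : WellFormed S → p < order S → WellFormed (addVertex S p)
  addVertex-wellFormed W p< = record { unique = unique′ ; bounded = bounded′ ; symmetric = symmetric′ }
    where
    n = order S
    below : ∀ {m} → m < suc n → m ≢ n → m < n
    below m< m≢n = ≤∧≢⇒< (≤-pred m<) m≢n
    unique′ : ∀ {m} → m < suc n → Unique (neighbours (addVertex S p) m)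
    unique′ {m} m< with m ≟ n
    ... | yes refl = [] ∷ []
    ... | no m≢n with m ≟ p
    ...   | yes refl = ¬Any⇒All¬ _ (λ n∈ → <-irrefl refl (bounded W p< n∈)) ∷ unique W p<
    ...   | no _ = unique W (below m< m≢n)
    bounded′ : ∀ {m j} → m < suc n → j ∈ neighbours (addVertex S p) m → j < suc n
    bounded′ {m} m< j∈ with ∈-addVertex⁻ {m} j∈
    ... | inj₁ (_ , refl) = m<n⇒m<1+n p<
    ... | inj₂ (inj₁ (_ , refl)) = n<1+n n
    ... | inj₂ (inj₂ (m≢n , j∈′)) = m<n⇒m<1+n (bounded W (below m< m≢n) j∈′)
    symmetric′ : ∀ {m j} → m < suc n → j ∈ neighbours (addVertex S p) m → m ∈ neighbours (addVertex S p) j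
    symmetric′ {m} m< j∈ with ∈-addVertex⁻ {m} j∈
    ... | inj₁ (refl , refl) = subst (n ∈_) (sym (addVertex-old p<)) (here refl)
    ... | inj₂ (inj₁ (refl , refl)) = subst (p ∈_) (sym addVertex-new) (here refl)
    ... | inj₂ (inj₂ (m≢n , j∈′)) =
      let m<n = below m< m≢n
      in ∈-addVertex⁺ (<⇒≢ (bounded W m<n j∈′)) (symmetric W m<n j∈′)

extend : {A : Set} → (ℕ → A) → ℕ → A → ℕ → A
extend ρ n t i = if ⌊ i ≟ n ⌋ then t else ρ i

extend-new : ∀ {A : Set} (ρ : ℕ → A) n t → extend ρ n t n ≡ t
extend-new ρ n t with n ≟ n
... | yes _ = refl
... | no n≢n = ⊥-elim (n≢n refl)

extend-old : ∀ {A : Set} (ρ : ℕ → A) {n} t {i} → i < n → extend ρ n t i ≡ ρ i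
extend-old ρ {n} t {i} i<n with i ≟ n
... | yes refl = ⊥-elim (<-irrefl refl i<n)
... | no _ = refl

labelled? : {A : Set} (_≟A_ : (a b : A) → Dec (a ≡ b)) (ρ : ℕ → A) (k : ℕ) (t : A) →
            (∃[ i ] i < k × ρ i ≡ t) ⊎ (∀ {i} → i < k → ρ i ≢ t)
labelled? _≟A_ ρ k t with any? (λ (j : Fin k) → ρ (toℕ j) ≟A t)
... | yes (j , ρj≡t) = inj₁ (toℕ j , toℕ<n j , ρj≡t)
... | no none = inj₂ λ i<k ρi≡t → none (fromℕ< i<k , subst (λ i → ρ i ≡ t) (sym (toℕ-fromℕ< i<k)) ρi≡t)

module Soundness {v : ℕ} (G : Graph v) (cubic : Regular G 3)
              (hexagonsPerEdge : ∀ u w → T (adj G u w) → cyclesThrough G 6 u w ≡ 2)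
              (noShortCycle : ∀ n → n < 6 → ¬ HasCycle G n) (small : v < 24) where

  open Cycles G
  open Cubic cubic
  open HexagonStructure cubic hexagonsPerEdge

  record Embedding (S : PartialGraph) (ρ : ℕ → Fin v) : Set where
    field
      injective : ∀ {i j} → i < order S → j < order S → ρ i ≡ ρ j → i ≡ j
      edges     : ∀ {i j} → i < order S → j ∈ neighbours S i → ρ i ~ ρ j
  open Embedding

  module _ {S : PartialGraph} {ρ : ℕ → Fin v} (E : Embedding S ρ) where

    map-unique : ∀ {l} → All (_< order S) l → Unique l → Unique (map ρ l)
    map-unique [] [] = []
    map-unique {i ∷ _} (i< ∷ l<) (i∉ ∷ !l) = fresh l< i∉ ∷ map-unique l< !l
      where
      fresh : ∀ {l} → All (_< order S) l → All (i ≢_) l → All (ρ i ≢_) (map ρ l)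
      fresh [] [] = []
      fresh (j< ∷ l<) (i≢j ∷ i∉) = (i≢j ∘ injective E i< j<) ∷ fresh l< i∉

    map-injective : ∀ {l l′} → All (_< order S) l → All (_< order S) l′ → map ρ l ≡ map ρ l′ → l ≡ l′
    map-injective [] [] refl = refl
    map-injective (i< ∷ l<) (j< ∷ l′<) eq =
      cong₂ _∷_ (injective E i< j< (∷-injectiveˡ eq)) (map-injective l< l′< (∷-injectiveʳ eq))

    knownPath-sound : ∀ {l} → All (_< order S) l → T (knownPath S l) → T (adjChain G (map ρ l))
    knownPath-sound {[]} _ _ = _
    knownPath-sound {_ ∷ []} _ _ = _
    knownPath-sound {i ∷ j ∷ l} (i< ∷ l<) h =
      let (j∈ , h′) = T-∧⁻ {j ∈ᵇ neighbours S i} h in T-∧⁺ (edges E i< (∈ᵇ⇒∈ j∈)) (knownPath-sound l< h′)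

    knownCycle-sound : ∀ {l} → T (knownCycle S l) → All (_< order S) l × T (isCycle G (map ρ l))
    knownCycle-sound {i ∷ l} h =
      let (three , h₁) = T-∧⁻ {3 ≤ᵇ length (i ∷ l)} h
          (labels< , h₂) = T-∧⁻ {all (_<ᵇ order S) (i ∷ l)} h₁
          (distinct , h₃) = T-∧⁻ {⌊ unique? (i ∷ l) ⌋} h₂
          (path , closing) = T-∧⁻ {knownPath S (i ∷ l)} h₃
          l< = All.map (<ᵇ⇒< _ _) (all⁺ _ (i ∷ l) labels<)
      in l< , T-∧⁺ (subst (T ∘ (3 ≤ᵇ_)) (sym (length-map ρ (i ∷ l))) three)
                (T-∧⁺ (Equivalence.from (allDistinct⇔Unique _) (map-unique l< (toWitness distinct)))
                  (T-∧⁺ (knownPath-sound l< path)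
                        (subst (λ z → z ~ ρ i) (sym (lastOf-map i l))
                               (edges E (lastLabel< l<) (∈ᵇ⇒∈ closing)))))
      where
      lastOf-map : ∀ i l → lastOf G (ρ i) (map ρ l) ≡ ρ (lastLabel i l)
      lastOf-map i [] = refl
      lastOf-map i (j ∷ l) = lastOf-map j l
      lastLabel< : ∀ {i l} → All (_< order S) (i ∷ l) → lastLabel i l < order S
      lastLabel< {l = []} (i< ∷ []) = i<
      lastLabel< {l = _ ∷ _} (_ ∷ l<) = lastLabel< l<

    knownHexagon-sound : ∀ {u y a b c x} → T (knownCycle S (u ∷ y ∷ a ∷ b ∷ c ∷ x ∷ [])) →
                         All (_< order S) (u ∷ y ∷ a ∷ b ∷ c ∷ x ∷ []) ×
                         Hexagon (ρ u) (ρ y) (ρ a) (ρ b) (ρ c) (ρ x)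
    knownHexagon-sound known =
      let (labels< , cycle) = knownCycle-sound known in labels< , isCycle⇒Hexagon cycle

    module _ (W : WellFormed S) where

      saturated-neighbour : ∀ {p t} → p < order S → ¬ T (free S p) → ρ p ~ t →
                            ∃[ j ] j ∈ neighbours S p × ρ j ≡ t
      saturated-neighbour {p} p< saturated p~t
        with ∈-map⁻ ρ (neighbour-in (map-unique (All.tabulate (bounded W p<)) (unique W p<))
                                    (All.map⁺ (All.tabulate (edges E p<)))
                                    (subst (3 ≤_) (sym (length-map ρ (neighbours S p))) (≮⇒≥ (saturated ∘ <⇒<ᵇ)))
                                    p~t)
      ... | j , j∈ , refl = j , j∈ , refl

      free-if-unlabelled : ∀ {p t} → p < order S → ρ p ~ t → (∀ {i} → i < order S → ρ i ≢ t) → T (free S p)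
      free-if-unlabelled p< p~t unlabelled = decidable-stable (T? _) λ saturated →
        let (j , j∈ , ρj≡t) = saturated-neighbour p< saturated p~t in unlabelled (bounded W p< j∈) ρj≡t

      free-if-unjoined : ∀ {p i} → p < order S → i < order S → ρ p ~ ρ i → i ∉ neighbours S p →
                         T (free S p) × T (free S i)
      free-if-unjoined {p} {i} p< i< p~i i∉ =
        decidable-stable (T? _) (λ saturated →
          let (j , j∈ , ρj≡ρi) = saturated-neighbour p< saturated p~i
          in i∉ (subst (_∈ neighbours S p) (injective E (bounded W p< j∈) i< ρj≡ρi) j∈)) ,
        decidable-stable (T? _) (λ saturated →
          let (j , j∈ , ρj≡ρp) = saturated-neighbour i< saturated (~-sym p~i)
          in i∉ (symmetric W i< (subst (_∈ neighbours S i) (injective E (bounded W i< j∈) p< ρj≡ρp) j∈)))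

  addEdge-embedding : ∀ {S ρ p i} → Embedding S ρ → p < order S → i < order S → ρ p ~ ρ i →
                      Embedding (addEdge S p i) ρ
  addEdge-embedding {S} {ρ} {p} {i} E p< i< p~i = record { injective = injective E ; edges = edges′ }
    where
    edges′ : ∀ {m j} → m < order S → j ∈ neighbours (addEdge S p i) m → ρ m ~ ρ j
    edges′ {m} m< j∈ with ∈-addEdge⁻ {S} {p} {i} {m} j∈
    ... | inj₁ (refl , refl) = p~i
    ... | inj₂ (inj₁ (refl , refl)) = ~-sym p~i
    ... | inj₂ (inj₂ j∈′) = edges E m< j∈′

  addVertex-embedding : ∀ {S ρ p t} → WellFormed S → Embedding S ρ → p < order S → ρ p ~ t →
                        (∀ {i} → i < order S → ρ i ≢ t) → Embedding (addVertex S p) (extend ρ (order S) t)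
  addVertex-embedding {S} {ρ} {p} {t} W E p< p~t unlabelled = record { injective = injective′ ; edges = edges′ }
    where
    n = order S
    ρ′ = extend ρ n t
    old : ∀ {i} → i < n → ρ′ i ≡ ρ i
    old = extend-old ρ t
    injective′ : ∀ {i j} → i < suc n → j < suc n → ρ′ i ≡ ρ′ j → i ≡ j
    injective′ {i} {j} i< j< eq with m<1+n⇒m<n∨m≡n i< | m<1+n⇒m<n∨m≡n j<
    ... | inj₁ i<n | inj₁ j<n = injective E i<n j<n (trans (sym (old i<n)) (trans eq (old j<n)))
    ... | inj₁ i<n | inj₂ refl =
      ⊥-elim (unlabelled i<n (trans (sym (old i<n)) (trans eq (extend-new ρ n t))))
    ... | inj₂ refl | inj₁ j<n =
      ⊥-elim (unlabelled j<n (trans (sym (old j<n)) (trans (sym eq) (extend-new ρ n t))))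
    ... | inj₂ refl | inj₂ refl = refl
    edges′ : ∀ {m j} → m < suc n → j ∈ neighbours (addVertex S p) m → ρ′ m ~ ρ′ j
    edges′ {m} m< j∈ with ∈-addVertex⁻ {S} {p} {m} j∈
    ... | inj₁ (refl , refl) = subst₂ _~_ (sym (extend-new ρ n t)) (sym (old p<)) (~-sym p~t)
    ... | inj₂ (inj₁ (refl , refl)) = subst₂ _~_ (sym (old p<)) (sym (extend-new ρ n t)) p~t
    ... | inj₂ (inj₂ (m≢n , j∈′)) =
      let m<n = ≤∧≢⇒< (≤-pred m<) m≢n
      in subst₂ _~_ (sym (old m<n)) (sym (old (bounded W m<n j∈′))) (edges E m<n j∈′)

  viaEdge-sound : ∀ {S ρ p i} {k : PartialGraph → Bool} → WellFormed S → Embedding S ρ →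
                  p < order S → i < order S → ρ p ~ ρ i → T (viaEdge S p i k) →
                  ∃[ S′ ] order S′ ≡ order S × WellFormed S′ × Embedding S′ ρ × T (k S′)
  viaEdge-sound {S} {ρ} {p} {i} W E p< i< p~i h with i ∈ᵇ neighbours S p in i∈?
  ... | true  = S , refl , W , E , h
  ... | false = addEdge S p i , refl ,
                addEdge-wellFormed W p< i< (λ { refl → ~-irrefl p~i }) i∉ ,
                addEdge-embedding E p< i< p~i ,
                ⇒ᵇ-elim h (T-∧⁺ (proj₁ unjoined) (proj₂ unjoined))
    where
    i∉ : i ∉ neighbours S p
    i∉ = subst T i∈? ∘ ∈⇒∈ᵇ
    unjoined = free-if-unjoined E W p< i< p~i i∉

  record Pending (k : ℕ) (ρ : ℕ → Fin v) (x p : ℕ) (trail : List ℕ) (rest : List (Fin v)) : Set where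
    field
      route    : T (adjChain G (ρ p ∷ rest ++ ρ x ∷ []))
      distinct : Unique (map ρ trail ++ rest)
      trail<   : All (_< k) trail
      p<       : p < k
      x<       : x < k
  open Pending

  Pending-first : ∀ {k ρ x p trail t rest} → Pending k ρ x p trail (t ∷ rest) → ρ p ~ t
  Pending-first P = proj₁ (T-∧⁻ (route P))

  Pending-last : ∀ {k ρ x p trail} → Pending k ρ x p trail [] → ρ p ~ ρ x
  Pending-last P = proj₁ (T-∧⁻ (route P))

  Pending-∉trail : ∀ {k ρ x p trail i rest} → Pending k ρ x p trail (ρ i ∷ rest) → i ∉ trail
  Pending-∉trail {ρ = ρ} P i∈ = unique-++-∷⇒∉ (distinct P) (∈-map⁺ ρ i∈)

  Pending-labelled : ∀ {k ρ x p trail i rest} → Pending k ρ x p trail (ρ i ∷ rest) → i < k →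
                     Pending k ρ x i (trail ∷ʳ i) rest
  Pending-labelled {ρ = ρ} {trail = trail} {i} {rest} P i< = record
    { route    = proj₂ (T-∧⁻ (route P))
    ; distinct = subst Unique (sym (map-∷ʳ-++ ρ trail i rest)) (distinct P)
    ; trail<   = ++⁺ (trail< P) (i< ∷ [])
    ; p<       = i<
    ; x<       = x< P
    }

  Pending-fresh : ∀ {k ρ x p trail t rest} → Pending k ρ x p trail (t ∷ rest) →
                  Pending (suc k) (extend ρ k t) x k (trail ∷ʳ k) rest
  Pending-fresh {k} {ρ} {x} {trail = trail} {t} {rest} P = record
    { route    = subst₂ (λ a b → T (adjChain G (a ∷ rest ++ b ∷ [])))
                        (sym (extend-new ρ k t)) (sym (extend-old ρ t (x< P))) (proj₂ (T-∧⁻ (route P)))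
    ; distinct = subst Unique (sym (trans (map-∷ʳ-++ ρ′ trail k rest)
                                         (cong₂ (λ l a → l ++ a ∷ rest)
                                                (map-extend (trail< P)) (extend-new ρ k t))))
                              (distinct P)
    ; trail<   = ++⁺ (All.map m<n⇒m<1+n (trail< P)) (n<1+n k ∷ [])
    ; p<       = n<1+n k
    ; x<       = m<n⇒m<1+n (x< P)
    }
    where
    ρ′ = extend ρ k t
    map-extend : ∀ {l} → All (_< k) l → map ρ′ l ≡ map ρ l
    map-extend [] = refl
    map-extend (i< ∷ l<) = cong₂ _∷_ (extend-old ρ t i<) (map-extend l<)

  CheckSound : ℕ → Set
  CheckSound n = ∀ c {S ρ} → WellFormed S → Embedding S ρ → ¬ T (check n S c)

  FollowSound : ℕ → Set
  FollowSound n = ∀ {r} (route : Route r) {S ρ x p trail rest} → length rest ≡ r → WellFormed S →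
                  Embedding S ρ → Pending (order S) ρ x p trail rest → ¬ T (follow n S x p trail route)

  pigeonhole-sound : ∀ {S ρ} → Embedding S ρ → ¬ T (24 ≤ᵇ order S)
  pigeonhole-sound {S} {ρ} E h with Fin.pigeonhole small (λ (i : Fin 24) → ρ (toℕ i))
  ... | i , j , i<j , ρi≡ρj = <-irrefl (injective E (label< i) (label< j) ρi≡ρj) i<j
    where
    label< : (i : Fin 24) → toℕ i < order S
    label< i = <-≤-trans (toℕ<n i) (≤ᵇ⇒≤ 24 (order S) h)

  shortCycle-sound : ∀ {S ρ} → Embedding S ρ → ∀ l → ¬ T (knownCycle S l ∧ (length l <ᵇ 6))
  shortCycle-sound {S} {ρ} E l h =
    let (known , short) = T-∧⁻ {knownCycle S l} h
    in noShortCycle (length l) (<ᵇ⇒< _ 6 short)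
                    (map ρ l , length-map ρ l , proj₂ (knownCycle-sound E {l} known))

  twoHexagons-sound : ∀ {n S ρ} → Embedding S ρ → ∀ x u y a b c a′ b′ c′ →
                      ¬ T (check (suc n) S (twoHexagons x u y a b c a′ b′ c′))
  twoHexagons-sound {S = S} E x u y a b c a′ b′ c′ h =
    let (known , h′) = T-∧⁻ {knownCycle S (u ∷ y ∷ a ∷ b ∷ c ∷ x ∷ [])} h
        (known′ , different) = T-∧⁻ {knownCycle S (u ∷ y ∷ a′ ∷ b′ ∷ c′ ∷ x ∷ [])} h′
        (labels< , H) = knownHexagon-sound E known
        (labels<′ , H′) = knownHexagon-sound E known′
    in toWitnessFalse different
         (map-injective E (All.take⁺ 3 (All.drop⁺ 2 labels<)) (All.take⁺ 3 (All.drop⁺ 2 labels<′))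
           (hexagon-unique H H′))

  newNeighbour-cases : ∀ {n} → CheckSound n → ∀ {u cs c S ρ t} → WellFormed S → Embedding S ρ →
                       u < order S → T (all (newNeighbourIs n S u cs) (upTo (order S))) →
                       T (check n (addVertex S u) c) → ρ u ~ t → t ∉ map ρ (neighbours S u) →
                       (∃[ i ] i < order S × ρ i ≡ t) ⊎ (∀ {i} → i < order S → ρ i ≢ t) → ⊥
  newNeighbour-cases sound W E u< branches next u~t t∉ (inj₂ unlabelled) =
    sound _ (addVertex-wellFormed W u<) (addVertex-embedding W E u< u~t unlabelled) next
  newNeighbour-cases {n} sound {u} {cs} {S = S} {ρ} W E u< branches next u~t t∉ (inj₁ (i , i< , refl)) =
    let (S′ , _ , W′ , E′ , h′) = viaEdge-sound {k = λ S′ → branch cs i (check n S′)} W E u< i< u~t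
                                                (newNeighbourIs⁻ {n} {S} {u} {cs} branches i< i∉)
        (c′ , h″) = branch⁻ {bs = cs} {i} h′
    in sound c′ W′ E′ h″
    where
    i∉ : i ∉ u ∷ neighbours S u
    i∉ (here refl) = ~-irrefl u~t
    i∉ (there i∈) = t∉ (∈-map⁺ ρ i∈)

  newNeighbour-sound : ∀ {n} → CheckSound n → ∀ u cs c {S ρ} → WellFormed S → Embedding S ρ →
                       ¬ T (check (suc n) S (newNeighbour u cs c))
  newNeighbour-sound {n} sound u cs c {S} {ρ} W E h =
    let (u< , h₁) = T-∧⁻ {u <ᵇ order S} h
        (free-u , h₂) = T-∧⁻ {free S u} h₁
        (branches , next) = T-∧⁻ {all (newNeighbourIs n S u cs) (upTo (order S))} h₂
        (t , u~t , t∉) = neighbour-outside {ρ u} {map ρ (neighbours S u)}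
                           (subst (_< 3) (sym (length-map ρ (neighbours S u))) (<ᵇ⇒< _ 3 free-u))
    in newNeighbour-cases {n} sound {u} {cs} {c} {S} {ρ} W E (<ᵇ⇒< u _ u<) branches next u~t t∉
         (labelled? Fin._≟_ ρ (order S) t)

  hexagon-pending : ∀ {k ρ x u y a b c} → Hexagon (ρ u) (ρ y) a b c (ρ x) → x < k → u < k → y < k →
                    Pending k ρ x y (x ∷ u ∷ y ∷ []) (a ∷ b ∷ c ∷ [])
  hexagon-pending H x< u< y< = record
    { route    = T-∧⁺ y~a (T-∧⁺ a~b (T-∧⁺ b~c (T-∧⁺ c~x _)))
    ; distinct = Hexagon-rotate H
    ; trail<   = x< ∷ u< ∷ y< ∷ []
    ; p<       = y<
    ; x<       = x<
    }
    where open Hexagon H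

  hexagonAt-sound : ∀ {n} → FollowSound n → ∀ x u y route {S ρ} → WellFormed S → Embedding S ρ →
                    ¬ T (check (suc n) S (hexagonAt x u y route))
  hexagonAt-sound {n} sound x u y route {S} {ρ} W E h =
    let (u< , h₁) = T-∧⁻ {u <ᵇ order S} h
        (x∈ , h₂) = T-∧⁻ {x ∈ᵇ neighbours S u} h₁
        (y∈ , h₃) = T-∧⁻ {y ∈ᵇ neighbours S u} h₂
        (x≢y , h₄) = T-∧⁻ {not (x ≡ᵇ y)} h₃
        u<′ = <ᵇ⇒< u _ u<
        x< = bounded W u<′ (∈ᵇ⇒∈ x∈)
        y< = bounded W u<′ (∈ᵇ⇒∈ y∈)
        (a , b , c , H) = hexagon-exists (edges E u<′ (∈ᵇ⇒∈ x∈)) (edges E u<′ (∈ᵇ⇒∈ y∈))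
                                         (T-not⁻ x≢y ∘ ≡⇒≡ᵇ x y ∘ injective E x< y<)
    in sound route {rest = a ∷ b ∷ c ∷ []} refl W E (hexagon-pending H x< u<′ y<) h₄

  close-sound : ∀ {n} → CheckSound n → ∀ c {S ρ x p trail} → WellFormed S → Embedding S ρ →
                Pending (order S) ρ x p trail [] → ¬ T (follow (suc n) S x p trail (close c))
  close-sound {n} sound c W E P h
    with viaEdge-sound {k = λ S′ → maybe′ (check n S′) false c} W E (p< P) (x< P) (Pending-last P) h
  close-sound sound (just c) W E P h | S′ , _ , W′ , E′ , h′ = sound c W′ E′ h′
  close-sound sound nothing  W E P h | _  , _ , _  , _  , h′ = h′

  advance-cases : ∀ {n r} → FollowSound n → ∀ {rs : List (ℕ × Route r)} {next S ρ x p trail t rest} →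
                  length rest ≡ r → WellFormed S → Embedding S ρ → Pending (order S) ρ x p trail (t ∷ rest) →
                  T (all (nextVertexIs n S x p trail rs) (upTo (order S))) →
                  T (free S p ⇒ᵇ maybe′ (follow n (addVertex S p) x (order S) (trail ∷ʳ order S)) false next) →
                  (∃[ i ] i < order S × ρ i ≡ t) ⊎ (∀ {i} → i < order S → ρ i ≢ t) → ⊥
  advance-cases {n} sound {rs} {S = S} {ρ} {x} {p} {trail} {rest = rest} len W E P branches _
                (inj₁ (i , i< , refl)) =
    let (S′ , order≡ , W′ , E′ , h′) =
          viaEdge-sound {k = λ S′ → branch rs i (follow n S′ x i (trail ∷ʳ i))} W E (p< P) i< (Pending-first P)
                        (nextVertexIs⁻ {n} {S} {x} {p} {trail} {rs = rs} branches i< (Pending-∉trail P))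
        (r′ , h″) = branch⁻ {bs = rs} {i} h′
    in sound r′ len W′ E′ (subst (λ k → Pending k ρ x i (trail ∷ʳ i) rest) (sym order≡) (Pending-labelled P i<))
             h″
  advance-cases sound {next = next} len W E P _ new (inj₂ unlabelled)
    with ⇒ᵇ-elim new (free-if-unlabelled E W (p< P) (Pending-first P) unlabelled)
  ... | h′ with next
  ...   | just r′ = sound r′ len (addVertex-wellFormed W (p< P))
                          (addVertex-embedding W E (p< P) (Pending-first P) unlabelled) (Pending-fresh P) h′
  ...   | nothing = h′

  advance-sound : ∀ {n r} → FollowSound n → (rs : List (ℕ × Route r)) (next : Maybe (Route r)) →
                  ∀ {S ρ x p trail t rest} → length rest ≡ r → WellFormed S → Embedding S ρ →
                  Pending (order S) ρ x p trail (t ∷ rest) → ¬ T (follow (suc n) S x p trail (advance rs next))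
  advance-sound {n} sound rs next {S} {ρ} {x} {p} {trail} {t} len W E P h =
    let (branches , new) = T-∧⁻ {all (nextVertexIs n S x p trail rs) (upTo (order S))} h
    in advance-cases {n} sound {rs} {next} {S} {ρ} {x} {p} {trail} len W E P branches new
         (labelled? Fin._≟_ ρ (order S) t)

  mutual
    check-sound : ∀ n → CheckSound n
    check-sound zero c W E ()
    check-sound (suc n) pigeonhole W E = pigeonhole-sound E
    check-sound (suc n) (shortCycle l) W E = shortCycle-sound E l
    check-sound (suc n) (twoHexagons x u y a b c a′ b′ c′) W E = twoHexagons-sound {n} E x u y a b c a′ b′ c′
    check-sound (suc n) (newNeighbour u cs c) W E = newNeighbour-sound {n} (check-sound n) u cs c W E
    check-sound (suc n) (hexagonAt x u y route) W E = hexagonAt-sound {n} (follow-sound n) x u y route W E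

    follow-sound : ∀ n → FollowSound n
    follow-sound zero route len W E P ()
    follow-sound (suc n) (close c) {rest = []} len W E P = close-sound {n} (check-sound n) c W E P
    follow-sound (suc n) (advance rs next) {rest = _ ∷ _} len W E P =
      advance-sound {n} (follow-sound n) rs next (suc-injective len) W E P
    follow-sound (suc n) (conclude c) len W E P = check-sound n c W E

-- The Nauru graph, i.e. the generalised Petersen graph GP(12,5): outer vertices i < 12 form a
-- 12-cycle, inner vertices 12 + i are joined to 12 + (i ± 5) mod 12, and spokes join i to 12 + i.
nauruNeighbours : ℕ → List ℕ
nauruNeighbours i =
  if i <ᵇ 12 then suc i % 12 ∷ (i + 11) % 12 ∷ 12 + i ∷ []
  else 12 + (i + 5) % 12 ∷ 12 + (i + 7) % 12 ∷ i ∸ 12 ∷ []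

nauruAdj : Fin 24 → Fin 24 → Bool
nauruAdj i j = any (toℕ j ≡ᵇ_) (nauruNeighbours (toℕ i))

nauru : Graph 24
nauru = record
  { adj    = nauruAdj
  ; sym    = toWitness {a? = all? λ i → all? λ j → nauruAdj i j Bool.≟ nauruAdj j i} tt
  ; irrefl = toWitness {a? = all? λ i → nauruAdj i i Bool.≟ false} tt
  }

open Cycles nauru

nauru-cubic : Regular nauru 3
nauru-cubic = toWitness {a? = all? λ i → degree nauru i ≟ 3} tt

nauru-connected : Connected nauru
nauru-connected = descending⇒connected nauru
  (toWitness {a? = all? λ i → (toℕ i ≟ 0) ⊎-dec any? λ j → T? (nauruAdj i j) ×-dec (toℕ j <? toℕ i)} tt)

nauru-girth : Girth nauru 6
nauru-girth = (# 0 ∷ # 1 ∷ # 2 ∷ # 14 ∷ # 19 ∷ # 12 ∷ [] , refl , tt) , no-short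
  where
  no-short : ∀ n → n < 6 → ¬ HasCycle nauru n
  no-short 0 _ = no-tiny-cycles nauru 0 (s≤s z≤n)
  no-short 1 _ = no-tiny-cycles nauru 1 (s≤s (s≤s z≤n))
  no-short 2 _ = no-tiny-cycles nauru 2 (s≤s (s≤s (s≤s z≤n)))
  no-short 3 _ = no-cycles 3 refl
  no-short 4 _ = no-cycles 4 refl
  no-short 5 _ = no-cycles 5 refl
  no-short (suc (suc (suc (suc (suc (suc _)))))) (s≤s (s≤s (s≤s (s≤s (s≤s (s≤s ()))))))

nauru-hexagons : ∀ u w → T (adj nauru u w) → cyclesThrough nauru 6 u w ≡ 2
nauru-hexagons u w u~w = trans (cyclesThrough≡pruned 6 u w)
  (toWitness {a? = all? λ u → all? λ w → T? (nauruAdj u w) →-dec (CyclesFrom.pruned u w [] 6 ≟ 2)} tt u w u~w)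

-- The search certificate

start : PartialGraph
start = record { order = 1 ; neighbours = λ _ → [] }

start-wellFormed : WellFormed start
start-wellFormed = record { unique = λ _ → [] ; bounded = λ _ () ; symmetric = λ _ () }

certificate : Certificate
certificate =
  newNeighbour 0 [] (newNeighbour 0 [] (hexagonAt 1 0 2 (advance [] (just (advance [] (just (advance
  [] (just (close (just (newNeighbour 0 ((3 , shortCycle (0 ∷ 2 ∷ 3 ∷ [])) ∷ (4 , shortCycle (0 ∷ 1
  ∷ 5 ∷ 4 ∷ [])) ∷ (5 , shortCycle (0 ∷ 1 ∷ 5 ∷ [])) ∷ []) (hexagonAt 1 0 6 (advance ((2 , conclude
  (shortCycle (0 ∷ 2 ∷ 6 ∷ []))) ∷ (3 , conclude (shortCycle (0 ∷ 2 ∷ 3 ∷ 6 ∷ []))) ∷ (4 , conclude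
  (shortCycle (0 ∷ 1 ∷ 5 ∷ 4 ∷ 6 ∷ []))) ∷ (5 , conclude (shortCycle (0 ∷ 1 ∷ 5 ∷ 6 ∷ []))) ∷ [])
  (just (advance ((2 , conclude (shortCycle (0 ∷ 2 ∷ 7 ∷ 6 ∷ []))) ∷ (3 , conclude (shortCycle (0 ∷
  2 ∷ 3 ∷ 7 ∷ 6 ∷ []))) ∷ (4 , conclude (twoHexagons 0 1 5 4 3 2 4 7 6)) ∷ (5 , conclude (shortCycle
  (0 ∷ 1 ∷ 5 ∷ 7 ∷ 6 ∷ []))) ∷ []) (just (advance ((2 , close nothing) ∷ (3 , close nothing) ∷ (4 ,
  close nothing) ∷ (5 , close (just (twoHexagons 0 1 5 4 3 2 8 7 6))) ∷ []) (just (close (just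
  (hexagonAt 2 0 6 (advance ((3 , conclude (shortCycle (0 ∷ 2 ∷ 3 ∷ 6 ∷ []))) ∷ (4 , conclude
  (shortCycle (0 ∷ 1 ∷ 5 ∷ 4 ∷ 6 ∷ []))) ∷ (5 , conclude (shortCycle (0 ∷ 1 ∷ 5 ∷ 6 ∷ []))) ∷ (7 ,
  advance ((3 , conclude (shortCycle (0 ∷ 2 ∷ 3 ∷ 7 ∷ 6 ∷ []))) ∷ (4 , conclude (twoHexagons 1 0 6 7
  8 9 7 4 5)) ∷ (5 , conclude (shortCycle (0 ∷ 1 ∷ 5 ∷ 7 ∷ 6 ∷ []))) ∷ (8 , advance ((3 , close
  (just (twoHexagons 1 0 2 3 4 5 3 8 9))) ∷ (4 , close nothing) ∷ (5 , close nothing) ∷ (9 , close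
  (just (shortCycle (0 ∷ 1 ∷ 9 ∷ 2 ∷ [])))) ∷ []) (just (close (just (twoHexagons 1 0 2 3 4 5 10 8
  9))))) ∷ (9 , conclude (shortCycle (7 ∷ 8 ∷ 9 ∷ []))) ∷ []) (just (advance ((3 , close (just
  (twoHexagons 0 2 3 4 5 1 10 7 6))) ∷ (4 , close nothing) ∷ (5 , close nothing) ∷ (8 , close
  nothing) ∷ (9 , close nothing) ∷ []) (just (close (just (twoHexagons 0 6 7 8 9 1 10 11 2))))))) ∷
  (8 , conclude (shortCycle (6 ∷ 7 ∷ 8 ∷ []))) ∷ (9 , conclude (shortCycle (0 ∷ 1 ∷ 9 ∷ 6 ∷ []))) ∷
  []) (just (advance ((3 , conclude (shortCycle (0 ∷ 2 ∷ 3 ∷ 10 ∷ 6 ∷ []))) ∷ (4 , conclude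
  (twoHexagons 1 0 6 7 8 9 10 4 5)) ∷ (5 , conclude (shortCycle (0 ∷ 1 ∷ 5 ∷ 10 ∷ 6 ∷ []))) ∷ (7 ,
  conclude (shortCycle (6 ∷ 7 ∷ 10 ∷ []))) ∷ (8 , conclude (shortCycle (6 ∷ 7 ∷ 8 ∷ 10 ∷ []))) ∷ (9
  , conclude (shortCycle (0 ∷ 1 ∷ 9 ∷ 10 ∷ 6 ∷ []))) ∷ []) (just (advance ((3 , close (just
  (twoHexagons 0 2 3 4 5 1 11 10 6))) ∷ (4 , close nothing) ∷ (5 , close nothing) ∷ (7 , close
  nothing) ∷ (8 , close nothing) ∷ (9 , close nothing) ∷ []) (just (close (just (hexagonAt 5 1 9
  (advance ((3 , conclude (shortCycle (0 ∷ 1 ∷ 9 ∷ 3 ∷ 2 ∷ []))) ∷ (4 , conclude (shortCycle (1 ∷ 5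
  ∷ 4 ∷ 9 ∷ []))) ∷ (7 , conclude (shortCycle (7 ∷ 8 ∷ 9 ∷ []))) ∷ (8 , advance ((3 , conclude
  (twoHexagons 1 0 2 3 4 5 3 8 9)) ∷ (4 , conclude (shortCycle (1 ∷ 5 ∷ 4 ∷ 8 ∷ 9 ∷ []))) ∷ (7 ,
  advance ((3 , close nothing) ∷ (4 , close (just (twoHexagons 1 0 6 7 8 9 7 4 5))) ∷ (6 , close
  nothing) ∷ (10 , close nothing) ∷ (11 , close nothing) ∷ (12 , close nothing) ∷ []) (just (close
  (just (twoHexagons 1 0 6 7 8 9 7 13 5))))) ∷ (10 , conclude (shortCycle (6 ∷ 7 ∷ 8 ∷ 10 ∷ []))) ∷
  (11 , conclude (shortCycle (6 ∷ 7 ∷ 8 ∷ 11 ∷ 10 ∷ []))) ∷ (12 , conclude (twoHexagons 1 0 2 3 4 5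
  12 8 9)) ∷ []) (just (advance ((3 , close nothing) ∷ (4 , close (just (twoHexagons 4 5 1 0 2 3 9 8
  13))) ∷ (7 , close nothing) ∷ (10 , close nothing) ∷ (11 , close nothing) ∷ (12 , close nothing) ∷
  []) (just (close (just (twoHexagons 8 9 1 0 6 7 5 14 13))))))) ∷ (10 , conclude (shortCycle (0 ∷ 1
  ∷ 9 ∷ 10 ∷ 6 ∷ []))) ∷ (11 , conclude (twoHexagons 1 0 2 3 4 5 12 11 9)) ∷ (12 , conclude
  (shortCycle (0 ∷ 1 ∷ 9 ∷ 12 ∷ 2 ∷ []))) ∷ []) (just (advance ((3 , conclude (twoHexagons 1 0 2 3 4
  5 3 13 9)) ∷ (4 , conclude (shortCycle (1 ∷ 5 ∷ 4 ∷ 13 ∷ 9 ∷ []))) ∷ (7 , conclude (shortCycle (7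
  ∷ 8 ∷ 9 ∷ 13 ∷ []))) ∷ (8 , conclude (shortCycle (8 ∷ 9 ∷ 13 ∷ []))) ∷ (10 , conclude (twoHexagons
  1 0 6 7 8 9 10 13 9)) ∷ (11 , advance ((10 , close (just (shortCycle (0 ∷ 1 ∷ 5 ∷ 10 ∷ 6 ∷ []))))
  ∷ (12 , close (just (shortCycle (0 ∷ 1 ∷ 5 ∷ 12 ∷ 2 ∷ [])))) ∷ []) nothing) ∷ (12 , conclude
  (twoHexagons 1 0 2 3 4 5 12 13 9)) ∷ []) (just (advance ((3 , close nothing) ∷ (4 , close (just
  (twoHexagons 4 5 1 0 2 3 9 13 14))) ∷ (7 , close nothing) ∷ (8 , close nothing) ∷ (10 , close
  nothing) ∷ (11 , close nothing) ∷ (12 , close nothing) ∷ []) (just (close (just (hexagonAt 12 2 3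
  (advance ((4 , advance ((5 , advance ((1 , close nothing) ∷ (15 , close (just (twoHexagons 1 0 2 3
  4 5 12 15 5))) ∷ []) nothing) ∷ (7 , conclude (twoHexagons 1 0 6 7 8 9 7 4 5)) ∷ (8 , conclude
  (shortCycle (1 ∷ 5 ∷ 4 ∷ 8 ∷ 9 ∷ []))) ∷ (10 , conclude (twoHexagons 1 0 6 7 8 9 10 4 5)) ∷ (11 ,
  conclude (shortCycle (2 ∷ 3 ∷ 4 ∷ 11 ∷ 12 ∷ []))) ∷ (13 , conclude (shortCycle (1 ∷ 5 ∷ 4 ∷ 13 ∷ 9
  ∷ []))) ∷ (14 , conclude (shortCycle (4 ∷ 5 ∷ 15 ∷ 14 ∷ []))) ∷ (15 , conclude (shortCycle (4 ∷ 5
  ∷ 15 ∷ []))) ∷ []) (just (advance ((7 , close nothing) ∷ (8 , close nothing) ∷ (10 , close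
  nothing) ∷ (11 , close (just (twoHexagons 2 3 4 5 1 0 16 11 12))) ∷ (13 , close nothing) ∷ (14 ,
  close nothing) ∷ (15 , close nothing) ∷ []) (just (close (just (twoHexagons 2 3 4 5 1 0 16 17
  12))))))) ∷ (7 , conclude (shortCycle (0 ∷ 2 ∷ 3 ∷ 7 ∷ 6 ∷ []))) ∷ (8 , conclude (twoHexagons 1 0
  2 3 4 5 3 8 9)) ∷ (10 , conclude (shortCycle (0 ∷ 2 ∷ 3 ∷ 10 ∷ 6 ∷ []))) ∷ (11 , conclude
  (shortCycle (2 ∷ 3 ∷ 11 ∷ 12 ∷ []))) ∷ (13 , conclude (twoHexagons 1 0 2 3 4 5 3 13 9)) ∷ (14 ,
  conclude (shortCycle (3 ∷ 4 ∷ 5 ∷ 15 ∷ 14 ∷ []))) ∷ (15 , conclude (shortCycle (3 ∷ 4 ∷ 5 ∷ 15 ∷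
  []))) ∷ []) (just (advance ((4 , conclude (shortCycle (3 ∷ 4 ∷ 16 ∷ []))) ∷ (7 , conclude
  (twoHexagons 2 0 6 7 16 3 10 11 12)) ∷ (8 , advance ((7 , close (just (shortCycle (0 ∷ 2 ∷ 12 ∷ 7
  ∷ 6 ∷ [])))) ∷ (9 , close nothing) ∷ []) nothing) ∷ (10 , conclude (twoHexagons 2 0 6 10 11 12 10
  16 3)) ∷ (11 , conclude (shortCycle (2 ∷ 3 ∷ 16 ∷ 11 ∷ 12 ∷ []))) ∷ (13 , advance ((9 , close
  nothing) ∷ (14 , close (just (hexagonAt 13 9 8 (advance ((4 , conclude (shortCycle (1 ∷ 5 ∷ 4 ∷ 8
  ∷ 9 ∷ []))) ∷ (7 , advance ((4 , conclude (twoHexagons 1 0 6 7 8 9 7 4 5)) ∷ (6 , advance ((0 ,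
  close nothing) ∷ (10 , close nothing) ∷ []) nothing) ∷ (10 , conclude (shortCycle (6 ∷ 7 ∷ 10 ∷
  []))) ∷ (11 , conclude (shortCycle (6 ∷ 7 ∷ 11 ∷ 10 ∷ []))) ∷ (15 , conclude (twoHexagons 1 0 6 7
  8 9 7 15 5)) ∷ (16 , conclude (shortCycle (7 ∷ 8 ∷ 9 ∷ 13 ∷ 16 ∷ []))) ∷ []) (just (advance ((4 ,
  close nothing) ∷ (10 , close nothing) ∷ (11 , close nothing) ∷ (15 , close nothing) ∷ (16 , close
  (just (twoHexagons 7 8 9 1 0 6 13 16 17))) ∷ []) (just (close nothing))))) ∷ (10 , conclude
  (shortCycle (6 ∷ 7 ∷ 8 ∷ 10 ∷ []))) ∷ (11 , conclude (shortCycle (6 ∷ 7 ∷ 8 ∷ 11 ∷ 10 ∷ []))) ∷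
  (15 , conclude (shortCycle (1 ∷ 5 ∷ 15 ∷ 8 ∷ 9 ∷ []))) ∷ (16 , conclude (shortCycle (8 ∷ 9 ∷ 13 ∷
  16 ∷ []))) ∷ []) (just (advance ((4 , conclude (twoHexagons 5 1 9 8 17 4 13 14 15)) ∷ (7 ,
  conclude (shortCycle (7 ∷ 8 ∷ 17 ∷ []))) ∷ (10 , conclude (shortCycle (6 ∷ 7 ∷ 8 ∷ 17 ∷ 10 ∷ [])))
  ∷ (11 , conclude (twoHexagons 6 7 8 9 1 0 17 11 10)) ∷ (15 , conclude (twoHexagons 5 1 9 8 17 15
  13 14 15)) ∷ (16 , conclude (shortCycle (8 ∷ 9 ∷ 13 ∷ 16 ∷ 17 ∷ []))) ∷ []) (just (advance ((4 ,
  close nothing) ∷ (7 , close nothing) ∷ (10 , close nothing) ∷ (11 , close nothing) ∷ (15 , close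
  nothing) ∷ (16 , close (just (hexagonAt 16 3 4 (advance ((5 , advance ((1 , advance ((0 , close
  nothing) ∷ (9 , close nothing) ∷ []) nothing) ∷ (15 , advance ((7 , close nothing) ∷ (10 , close
  nothing) ∷ (11 , close nothing) ∷ (14 , close nothing) ∷ (17 , close nothing) ∷ (18 , close (just
  (shortCycle (13 ∷ 14 ∷ 15 ∷ 18 ∷ 16 ∷ [])))) ∷ []) (just (close nothing))) ∷ []) nothing) ∷ (7 ,
  conclude (twoHexagons 1 0 6 7 8 9 7 4 5)) ∷ (10 , conclude (twoHexagons 1 0 6 7 8 9 10 4 5)) ∷ (11
  , conclude (shortCycle (2 ∷ 3 ∷ 4 ∷ 11 ∷ 12 ∷ []))) ∷ (15 , conclude (shortCycle (4 ∷ 5 ∷ 15 ∷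
  []))) ∷ (17 , conclude (shortCycle (3 ∷ 4 ∷ 17 ∷ 18 ∷ 16 ∷ []))) ∷ (18 , conclude (shortCycle (3 ∷
  4 ∷ 18 ∷ 16 ∷ []))) ∷ []) (just (advance ((7 , advance ((6 , close nothing) ∷ (8 , close nothing)
  ∷ []) nothing) ∷ (10 , advance ((6 , close nothing) ∷ (11 , close nothing) ∷ []) nothing) ∷ (11 ,
  conclude (twoHexagons 3 2 12 11 19 4 14 13 16)) ∷ (15 , conclude (shortCycle (4 ∷ 5 ∷ 15 ∷ 19 ∷
  []))) ∷ (17 , conclude (twoHexagons 17 18 16 3 4 19 13 9 8)) ∷ (18 , conclude (shortCycle (3 ∷ 4 ∷
  19 ∷ 18 ∷ 16 ∷ []))) ∷ []) (just (advance ((7 , close nothing) ∷ (10 , close nothing) ∷ (11 ,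
  close nothing) ∷ (15 , close nothing) ∷ (17 , close nothing) ∷ (18 , close (just (hexagonAt 5 4 19
  (advance ((7 , conclude (twoHexagons 8 17 18 16 13 9 20 19 7)) ∷ (10 , advance ((6 , advance ((0 ,
  close nothing) ∷ (7 , close nothing) ∷ []) nothing) ∷ (11 , advance ((7 , close nothing) ∷ (12 ,
  close nothing) ∷ (15 , close (just (shortCycle (11 ∷ 12 ∷ 14 ∷ 15 ∷ [])))) ∷ (17 , close nothing)
  ∷ (20 , close nothing) ∷ []) (just (close nothing))) ∷ []) nothing) ∷ (11 , conclude (twoHexagons
  3 2 12 11 19 4 14 13 16)) ∷ (15 , conclude (shortCycle (4 ∷ 5 ∷ 15 ∷ 19 ∷ []))) ∷ (17 , conclude
  (shortCycle (17 ∷ 18 ∷ 20 ∷ 19 ∷ []))) ∷ (20 , advance ((7 , conclude (shortCycle (7 ∷ 8 ∷ 17 ∷ 18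
  ∷ 20 ∷ []))) ∷ (10 , advance ((6 , close nothing) ∷ (11 , close nothing) ∷ []) nothing) ∷ (11 ,
  advance ((10 , close nothing) ∷ (12 , close nothing) ∷ []) nothing) ∷ (15 , conclude (shortCycle
  (4 ∷ 5 ∷ 15 ∷ 20 ∷ 19 ∷ []))) ∷ (17 , conclude (shortCycle (17 ∷ 18 ∷ 20 ∷ []))) ∷ (18 , advance
  ((16 , close nothing) ∷ (17 , close nothing) ∷ []) nothing) ∷ []) (just (advance ((7 , close
  nothing) ∷ (10 , close nothing) ∷ (11 , close nothing) ∷ (15 , close (just (twoHexagons 4 19 20 18
  16 3 21 15 5))) ∷ (17 , close nothing) ∷ []) (just (close nothing))))) ∷ []) (just (advance ((7 ,
  advance ((6 , close nothing) ∷ (8 , close nothing) ∷ []) nothing) ∷ (10 , advance ((6 , close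
  nothing) ∷ (11 , close nothing) ∷ []) nothing) ∷ (11 , advance ((10 , close nothing) ∷ (12 , close
  nothing) ∷ []) nothing) ∷ (15 , conclude (shortCycle (4 ∷ 5 ∷ 15 ∷ 21 ∷ 19 ∷ []))) ∷ (17 ,
  conclude (shortCycle (17 ∷ 18 ∷ 20 ∷ 19 ∷ 21 ∷ []))) ∷ (20 , conclude (shortCycle (19 ∷ 20 ∷ 21 ∷
  []))) ∷ []) (just (advance ((7 , close nothing) ∷ (10 , close nothing) ∷ (11 , close nothing) ∷
  (15 , close (just (hexagonAt 10 6 7 (advance ((8 , advance ((9 , advance ((1 , close nothing) ∷
  (13 , close nothing) ∷ []) nothing) ∷ (17 , advance ((11 , close (just (twoHexagons 6 7 8 9 1 0 17
  11 10))) ∷ (18 , close nothing) ∷ (20 , close nothing) ∷ (21 , close nothing) ∷ (22 , close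
  nothing) ∷ []) (just (close (just pigeonhole)))) ∷ []) nothing) ∷ (11 , conclude (shortCycle (6 ∷
  7 ∷ 11 ∷ 10 ∷ []))) ∷ (17 , conclude (shortCycle (7 ∷ 8 ∷ 17 ∷ []))) ∷ (20 , conclude (shortCycle
  (7 ∷ 8 ∷ 17 ∷ 18 ∷ 20 ∷ []))) ∷ (21 , advance ((19 , advance ((4 , close nothing) ∷ (20 , close
  (just (hexagonAt 8 7 21 (advance ((19 , advance ((4 , advance ((3 , close nothing) ∷ (5 , close
  nothing) ∷ []) nothing) ∷ (20 , advance ((10 , close nothing) ∷ (18 , close nothing) ∷ [])
  nothing) ∷ []) nothing) ∷ (22 , advance ((11 , conclude (shortCycle (11 ∷ 12 ∷ 14 ∷ 15 ∷ 22 ∷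
  []))) ∷ (15 , advance ((5 , close nothing) ∷ (14 , close nothing) ∷ []) nothing) ∷ (17 , conclude
  (shortCycle (7 ∷ 8 ∷ 17 ∷ 22 ∷ 21 ∷ []))) ∷ []) (just (conclude pigeonhole))) ∷ []) nothing)))) ∷
  []) nothing) ∷ (22 , advance ((11 , close (just (shortCycle (11 ∷ 12 ∷ 14 ∷ 15 ∷ 22 ∷ [])))) ∷ (15
  , close nothing) ∷ (17 , close nothing) ∷ (20 , close nothing) ∷ []) (just (close (just
  pigeonhole)))) ∷ []) nothing) ∷ (22 , advance ((15 , advance ((5 , close nothing) ∷ (14 , close
  nothing) ∷ []) nothing) ∷ (21 , advance ((11 , close (just (twoHexagons 6 10 11 12 2 0 21 22 7)))
  ∷ (17 , close nothing) ∷ (19 , close nothing) ∷ (20 , close nothing) ∷ []) (just (close (just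
  pigeonhole)))) ∷ []) nothing) ∷ []) (just (conclude pigeonhole)))))) ∷ (17 , close nothing) ∷ (20
  , close nothing) ∷ []) (just (close nothing)))))))))) ∷ []) (just (close nothing)))))))))) ∷ [])
  (just (close nothing)))))))))) ∷ []) nothing) ∷ (14 , conclude (twoHexagons 3 4 5 1 0 2 15 14 16))
  ∷ (15 , conclude (shortCycle (3 ∷ 4 ∷ 5 ∷ 15 ∷ 16 ∷ []))) ∷ []) (just (advance ((4 , close
  nothing) ∷ (7 , close nothing) ∷ (8 , close nothing) ∷ (10 , close nothing) ∷ (11 , close (just
  (twoHexagons 11 12 2 0 6 10 3 16 17))) ∷ (13 , close nothing) ∷ (14 , close nothing) ∷ (15 , close
  nothing) ∷ []) (just (close (just (hexagonAt 16 3 4 (advance ((5 , advance ((1 , advance ((0 ,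
  close nothing) ∷ (9 , close nothing) ∷ []) nothing) ∷ (15 , advance ((7 , close nothing) ∷ (8 ,
  close nothing) ∷ (10 , close nothing) ∷ (11 , close nothing) ∷ (13 , close nothing) ∷ (14 , close
  (just (twoHexagons 3 4 5 1 0 2 15 14 16))) ∷ (17 , close (just (twoHexagons 3 4 5 1 0 2 15 17
  16))) ∷ (18 , close nothing) ∷ []) (just (close (just (twoHexagons 3 4 5 1 0 2 15 19 16))))) ∷ [])
  nothing) ∷ (7 , conclude (twoHexagons 1 0 6 7 8 9 7 4 5)) ∷ (8 , conclude (shortCycle (1 ∷ 5 ∷ 4 ∷
  8 ∷ 9 ∷ []))) ∷ (10 , conclude (twoHexagons 1 0 6 7 8 9 10 4 5)) ∷ (11 , conclude (shortCycle (2 ∷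
  3 ∷ 4 ∷ 11 ∷ 12 ∷ []))) ∷ (13 , conclude (shortCycle (1 ∷ 5 ∷ 4 ∷ 13 ∷ 9 ∷ []))) ∷ (14 , conclude
  (shortCycle (4 ∷ 5 ∷ 15 ∷ 14 ∷ []))) ∷ (15 , conclude (shortCycle (4 ∷ 5 ∷ 15 ∷ []))) ∷ (17 ,
  conclude (shortCycle (3 ∷ 4 ∷ 17 ∷ 16 ∷ []))) ∷ (18 , conclude (shortCycle (2 ∷ 3 ∷ 4 ∷ 18 ∷ 12 ∷
  []))) ∷ []) (just (advance ((7 , advance ((6 , close nothing) ∷ (8 , close (just (hexagonAt 5 4 19
  (advance ((7 , advance ((6 , advance ((0 , close nothing) ∷ (10 , close nothing) ∷ []) nothing) ∷
  (8 , advance ((9 , close nothing) ∷ (16 , close nothing) ∷ []) nothing) ∷ []) nothing) ∷ (10 ,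
  conclude (shortCycle (6 ∷ 7 ∷ 19 ∷ 10 ∷ []))) ∷ (11 , conclude (shortCycle (6 ∷ 7 ∷ 19 ∷ 11 ∷ 10 ∷
  []))) ∷ (13 , conclude (shortCycle (7 ∷ 8 ∷ 9 ∷ 13 ∷ 19 ∷ []))) ∷ (14 , conclude (shortCycle (4 ∷
  5 ∷ 15 ∷ 14 ∷ 19 ∷ []))) ∷ (15 , conclude (shortCycle (4 ∷ 5 ∷ 15 ∷ 19 ∷ []))) ∷ (17 , conclude
  (shortCycle (3 ∷ 4 ∷ 19 ∷ 17 ∷ 16 ∷ []))) ∷ (18 , conclude (twoHexagons 3 2 12 18 17 16 18 19 4))
  ∷ []) (just (advance ((10 , conclude (shortCycle (6 ∷ 7 ∷ 19 ∷ 20 ∷ 10 ∷ []))) ∷ (11 , conclude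
  (twoHexagons 6 10 11 12 2 0 20 19 7)) ∷ (13 , conclude (twoHexagons 8 7 19 4 3 16 20 13 9)) ∷ (14
  , conclude (twoHexagons 14 15 5 4 19 20 1 9 13)) ∷ (15 , conclude (shortCycle (4 ∷ 5 ∷ 15 ∷ 20 ∷
  19 ∷ []))) ∷ (17 , conclude (twoHexagons 4 3 16 17 20 19 8 7 19)) ∷ (18 , advance ((12 , close
  nothing) ∷ (17 , close nothing) ∷ []) nothing) ∷ []) (just (advance ((10 , close nothing) ∷ (11 ,
  close nothing) ∷ (13 , close nothing) ∷ (14 , close nothing) ∷ (15 , close (just (hexagonAt 7 6 10
  (advance ((11 , advance ((12 , advance ((2 , close nothing) ∷ (18 , close nothing) ∷ []) nothing)
  ∷ (13 , advance ((9 , close nothing) ∷ (14 , close nothing) ∷ []) nothing) ∷ (14 , advance ((13 ,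
  close nothing) ∷ (15 , close nothing) ∷ []) nothing) ∷ (17 , conclude (shortCycle (11 ∷ 12 ∷ 18 ∷
  17 ∷ []))) ∷ (18 , conclude (shortCycle (11 ∷ 12 ∷ 18 ∷ []))) ∷ (20 , conclude (twoHexagons 6 10
  11 12 2 0 20 19 7)) ∷ (21 , advance ((15 , close nothing) ∷ (20 , close nothing) ∷ []) nothing) ∷
  []) (just (advance ((13 , close nothing) ∷ (14 , close nothing) ∷ (17 , close nothing) ∷ (18 ,
  close nothing) ∷ (20 , close nothing) ∷ (21 , close nothing) ∷ []) (just (close nothing))))) ∷ (13
  , conclude (twoHexagons 1 0 6 7 8 9 10 13 9)) ∷ (14 , advance ((13 , advance ((9 , close nothing)
  ∷ (11 , close nothing) ∷ (17 , close nothing) ∷ (18 , close nothing) ∷ (20 , close nothing) ∷ (21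
  , close nothing) ∷ []) (just (close nothing))) ∷ (15 , advance ((5 , close nothing) ∷ (21 , close
  nothing) ∷ []) nothing) ∷ []) nothing) ∷ (17 , conclude (shortCycle (10 ∷ 11 ∷ 12 ∷ 18 ∷ 17 ∷
  []))) ∷ (18 , conclude (shortCycle (10 ∷ 11 ∷ 12 ∷ 18 ∷ []))) ∷ (20 , conclude (shortCycle (6 ∷ 7
  ∷ 19 ∷ 20 ∷ 10 ∷ []))) ∷ (21 , conclude (twoHexagons 19 20 21 15 5 4 10 6 7)) ∷ []) (just (advance
  ((11 , conclude (shortCycle (10 ∷ 11 ∷ 22 ∷ []))) ∷ (13 , advance ((9 , close nothing) ∷ (14 ,
  close nothing) ∷ []) nothing) ∷ (14 , advance ((13 , close nothing) ∷ (15 , close nothing) ∷ [])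
  nothing) ∷ (17 , conclude (twoHexagons 10 11 12 2 0 6 18 17 22)) ∷ (18 , conclude (shortCycle (10
  ∷ 11 ∷ 12 ∷ 18 ∷ 22 ∷ []))) ∷ (20 , advance ((19 , close (just (hexagonAt 9 8 16 (advance ((3 ,
  advance ((2 , advance ((0 , close nothing) ∷ (12 , close nothing) ∷ []) nothing) ∷ (4 , advance
  ((5 , close nothing) ∷ (19 , close nothing) ∷ []) nothing) ∷ []) nothing) ∷ (17 , advance ((11 ,
  conclude (shortCycle (11 ∷ 12 ∷ 18 ∷ 17 ∷ []))) ∷ (13 , conclude (shortCycle (8 ∷ 9 ∷ 13 ∷ 17 ∷ 16
  ∷ []))) ∷ (14 , conclude (twoHexagons 9 13 14 15 5 1 17 16 8)) ∷ (18 , advance ((11 , close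
  nothing) ∷ (12 , close nothing) ∷ (13 , close (just (twoHexagons 16 17 18 12 2 3 13 9 8))) ∷ (14 ,
  close nothing) ∷ (21 , close nothing) ∷ (22 , close nothing) ∷ []) (just (close nothing))) ∷ (21 ,
  advance ((15 , close nothing) ∷ (20 , close nothing) ∷ []) nothing) ∷ (22 , conclude (twoHexagons
  10 11 12 2 0 6 18 17 22)) ∷ []) (just (conclude pigeonhole))) ∷ []) nothing)))) ∷ (21 , close
  nothing) ∷ []) nothing) ∷ (21 , advance ((15 , close nothing) ∷ (20 , close nothing) ∷ [])
  nothing) ∷ []) (just (conclude pigeonhole)))))))) ∷ (17 , close nothing) ∷ (18 , close nothing) ∷
  []) (just (close nothing)))))))))) ∷ []) nothing) ∷ (8 , conclude (twoHexagons 5 1 9 8 19 4 13 14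
  15)) ∷ (10 , advance ((6 , close nothing) ∷ (11 , close (just (shortCycle (2 ∷ 3 ∷ 16 ∷ 11 ∷ 12 ∷
  [])))) ∷ []) nothing) ∷ (11 , conclude (twoHexagons 3 2 12 11 19 4 18 17 16)) ∷ (13 , conclude
  (twoHexagons 5 1 9 13 14 15 13 19 4)) ∷ (14 , conclude (shortCycle (4 ∷ 5 ∷ 15 ∷ 14 ∷ 19 ∷ []))) ∷
  (15 , conclude (shortCycle (4 ∷ 5 ∷ 15 ∷ 19 ∷ []))) ∷ (17 , conclude (shortCycle (3 ∷ 4 ∷ 19 ∷ 17
  ∷ 16 ∷ []))) ∷ (18 , conclude (twoHexagons 3 2 12 18 17 16 18 19 4)) ∷ []) (just (advance ((7 ,
  close nothing) ∷ (8 , close nothing) ∷ (10 , close nothing) ∷ (11 , close nothing) ∷ (13 , close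
  nothing) ∷ (14 , close nothing) ∷ (15 , close nothing) ∷ (17 , close (just (twoHexagons 3 16 17 18
  12 2 20 19 4))) ∷ (18 , close nothing) ∷ []) (just (close (just (hexagonAt 5 4 19 (advance ((7 ,
  advance ((6 , advance ((0 , close nothing) ∷ (10 , close nothing) ∷ []) nothing) ∷ (8 , advance
  ((9 , close nothing) ∷ (10 , close nothing) ∷ (11 , close nothing) ∷ (13 , close nothing) ∷ (14 ,
  close nothing) ∷ (15 , close (just (shortCycle (1 ∷ 5 ∷ 15 ∷ 8 ∷ 9 ∷ [])))) ∷ (17 , close nothing)
  ∷ (18 , close nothing) ∷ (20 , close nothing) ∷ (21 , close nothing) ∷ []) (just (close nothing)))
  ∷ []) nothing) ∷ (8 , conclude (twoHexagons 5 1 9 8 19 4 13 14 15)) ∷ (10 , advance ((6 , advance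
  ((0 , close nothing) ∷ (7 , close nothing) ∷ []) nothing) ∷ (11 , advance ((7 , close nothing) ∷
  (8 , close nothing) ∷ (12 , close nothing) ∷ (13 , close nothing) ∷ (14 , close nothing) ∷ (15 ,
  close (just (hexagonAt 10 6 7 (advance ((8 , advance ((9 , advance ((1 , close nothing) ∷ (13 ,
  close nothing) ∷ []) nothing) ∷ (13 , conclude (shortCycle (8 ∷ 9 ∷ 13 ∷ []))) ∷ (14 , conclude
  (shortCycle (8 ∷ 9 ∷ 13 ∷ 14 ∷ []))) ∷ (17 , advance ((16 , close nothing) ∷ (18 , close nothing)
  ∷ []) nothing) ∷ (18 , advance ((12 , close nothing) ∷ (17 , close nothing) ∷ []) nothing) ∷ (20 ,
  conclude (twoHexagons 6 7 8 9 1 0 20 19 10)) ∷ (21 , advance ((16 , close nothing) ∷ (20 , close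
  nothing) ∷ []) nothing) ∷ []) (just (advance ((13 , close nothing) ∷ (14 , close nothing) ∷ (17 ,
  close nothing) ∷ (18 , close nothing) ∷ (20 , close nothing) ∷ (21 , close nothing) ∷ []) (just
  (close nothing))))) ∷ (13 , conclude (shortCycle (7 ∷ 8 ∷ 9 ∷ 13 ∷ []))) ∷ (14 , conclude
  (shortCycle (7 ∷ 8 ∷ 9 ∷ 13 ∷ 14 ∷ []))) ∷ (17 , advance ((16 , advance ((3 , close nothing) ∷ (21
  , close nothing) ∷ []) nothing) ∷ (18 , advance ((8 , close nothing) ∷ (12 , close nothing) ∷ (13
  , close nothing) ∷ (14 , close nothing) ∷ (20 , close nothing) ∷ (21 , close nothing) ∷ []) (just
  (close nothing))) ∷ []) nothing) ∷ (18 , conclude (twoHexagons 2 0 6 7 18 12 10 11 12)) ∷ (20 ,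
  conclude (shortCycle (6 ∷ 7 ∷ 20 ∷ 19 ∷ 10 ∷ []))) ∷ (21 , conclude (twoHexagons 19 20 21 16 3 4 7
  6 10)) ∷ []) (just (advance ((8 , conclude (shortCycle (7 ∷ 8 ∷ 22 ∷ []))) ∷ (13 , conclude
  (shortCycle (7 ∷ 8 ∷ 9 ∷ 13 ∷ 22 ∷ []))) ∷ (14 , conclude (twoHexagons 7 8 9 1 0 6 13 14 22)) ∷
  (17 , advance ((16 , close nothing) ∷ (18 , close nothing) ∷ []) nothing) ∷ (18 , advance ((12 ,
  close nothing) ∷ (17 , close nothing) ∷ []) nothing) ∷ (20 , advance ((19 , close (just (hexagonAt
  8 7 22 (advance ((13 , conclude (shortCycle (7 ∷ 8 ∷ 9 ∷ 13 ∷ 22 ∷ []))) ∷ (14 , conclude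
  (twoHexagons 7 8 9 1 0 6 13 14 22)) ∷ (17 , conclude (shortCycle (16 ∷ 17 ∷ 22 ∷ 20 ∷ 21 ∷ []))) ∷
  (18 , conclude (twoHexagons 16 17 18 12 2 3 22 20 21)) ∷ (20 , advance ((19 , advance ((4 , close
  nothing) ∷ (10 , close nothing) ∷ []) nothing) ∷ (21 , advance ((13 , close nothing) ∷ (14 , close
  nothing) ∷ (16 , close nothing) ∷ (17 , close nothing) ∷ (18 , close nothing) ∷ []) (just (close
  (just pigeonhole)))) ∷ []) nothing) ∷ (21 , conclude (shortCycle (20 ∷ 21 ∷ 22 ∷ []))) ∷ []) (just
  (conclude pigeonhole)))))) ∷ (21 , close nothing) ∷ []) nothing) ∷ (21 , advance ((16 , close
  nothing) ∷ (20 , close nothing) ∷ []) nothing) ∷ []) (just (conclude pigeonhole)))))))) ∷ (17 ,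
  close nothing) ∷ (18 , close nothing) ∷ (20 , close nothing) ∷ (21 , close nothing) ∷ []) (just
  (close nothing))) ∷ []) nothing) ∷ (11 , conclude (twoHexagons 3 2 12 11 19 4 18 17 16)) ∷ (13 ,
  conclude (twoHexagons 5 1 9 13 14 15 13 19 4)) ∷ (14 , conclude (shortCycle (4 ∷ 5 ∷ 15 ∷ 14 ∷ 19
  ∷ []))) ∷ (15 , conclude (shortCycle (4 ∷ 5 ∷ 15 ∷ 19 ∷ []))) ∷ (17 , conclude (shortCycle (3 ∷ 4
  ∷ 19 ∷ 17 ∷ 16 ∷ []))) ∷ (18 , conclude (twoHexagons 3 2 12 18 17 16 18 19 4)) ∷ (20 , advance ((7
  , advance ((6 , close nothing) ∷ (8 , close nothing) ∷ []) nothing) ∷ (8 , advance ((7 , close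
  nothing) ∷ (9 , close nothing) ∷ []) nothing) ∷ (10 , advance ((6 , close nothing) ∷ (11 , close
  nothing) ∷ []) nothing) ∷ (11 , advance ((10 , close nothing) ∷ (12 , close nothing) ∷ [])
  nothing) ∷ (13 , advance ((9 , close nothing) ∷ (14 , close nothing) ∷ []) nothing) ∷ (14 ,
  conclude (twoHexagons 14 15 5 4 19 20 1 9 13)) ∷ (15 , conclude (shortCycle (4 ∷ 5 ∷ 15 ∷ 20 ∷ 19
  ∷ []))) ∷ (17 , conclude (shortCycle (16 ∷ 17 ∷ 20 ∷ 21 ∷ []))) ∷ (18 , conclude (shortCycle (16 ∷
  17 ∷ 18 ∷ 20 ∷ 21 ∷ []))) ∷ (21 , advance ((7 , close nothing) ∷ (8 , close nothing) ∷ (10 , close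
  nothing) ∷ (11 , close nothing) ∷ (13 , close nothing) ∷ (14 , close nothing) ∷ (15 , close (just
  (twoHexagons 4 3 16 21 20 19 21 15 5))) ∷ (16 , close nothing) ∷ (17 , close nothing) ∷ (18 ,
  close nothing) ∷ []) (just (close nothing))) ∷ []) (just (advance ((7 , close nothing) ∷ (8 ,
  close nothing) ∷ (10 , close nothing) ∷ (11 , close nothing) ∷ (13 , close nothing) ∷ (14 , close
  nothing) ∷ (15 , close (just (twoHexagons 4 19 20 21 16 3 22 15 5))) ∷ (17 , close nothing) ∷ (18
  , close nothing) ∷ (21 , close nothing) ∷ []) (just (close nothing))))) ∷ (21 , conclude
  (shortCycle (19 ∷ 20 ∷ 21 ∷ []))) ∷ []) (just (advance ((7 , advance ((6 , close nothing) ∷ (8 ,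
  close nothing) ∷ []) nothing) ∷ (8 , advance ((7 , close nothing) ∷ (9 , close nothing) ∷ [])
  nothing) ∷ (10 , advance ((6 , close nothing) ∷ (11 , close nothing) ∷ []) nothing) ∷ (11 ,
  advance ((10 , close nothing) ∷ (12 , close nothing) ∷ []) nothing) ∷ (13 , advance ((9 , close
  nothing) ∷ (14 , close nothing) ∷ []) nothing) ∷ (14 , conclude (twoHexagons 14 15 5 4 19 22 1 9
  13)) ∷ (15 , conclude (shortCycle (4 ∷ 5 ∷ 15 ∷ 22 ∷ 19 ∷ []))) ∷ (17 , conclude (twoHexagons 4 3
  16 17 22 19 21 20 19)) ∷ (18 , advance ((12 , close nothing) ∷ (17 , close nothing) ∷ []) nothing)
  ∷ (20 , conclude (shortCycle (19 ∷ 20 ∷ 22 ∷ []))) ∷ (21 , conclude (shortCycle (19 ∷ 20 ∷ 21 ∷ 22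
  ∷ []))) ∷ []) (just (conclude
  pigeonhole))))))))))))))))))))))))))))))))))))))))))))))))))))))))))))))

certificate-valid : T (check 100 start certificate)
certificate-valid = tt

no-egr-below-24 : ∀ v → v < 24 → ¬ EGR v 3 6 2
no-egr-below-24 v v<24 (G , _ , cubic , (([] , () , _) , _) , _)
no-egr-below-24 v v<24 (G , _ , cubic , ((x₀ ∷ _ , _) , noShortCycle) , hexagons) =
  check-sound 100 certificate start-wellFormed embedding certificate-valid
  where
  open Soundness G cubic hexagons noShortCycle v<24
  embedding : Embedding start (λ _ → x₀)
  embedding = record { injective = λ { (s≤s z≤n) (s≤s z≤n) _ → refl } ; edges = λ _ () }

mainTheorem2 : NEquals 3 6 2 24
mainTheorem2 = (nauru , nauru-connected , nauru-cubic , nauru-girth , nauru-hexagons) , no-egr-below-24
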